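{- Let $p=(12,\{(0,1),(1,1),(1,2),(2,1)\})$. For every $n\ge 2$, \[\sum_{\pi\in S_n(p)} x^{\operatorname{des}(\pi)} = x\,E_{n-1}(x),\] and $|S_n(p)|=(n-1)!$ for all $n\ge 1$.
   Context: $S_n$ is the set of permutations of $\{1,\dots,n\}$, written $\pi=\pi_1\cdots\pi_n$; $\operatorname{des}(\pi)$ is the number of indices $i$ with $\pi_i>\pi_{i+1}$. A mesh pattern $(12,R)$ of length 2 has $R\subseteq\{0,1,2\}^2$ (shaded boxes). A permutation $\pi\in S_n$ contains $(12,R)$ if there exist indices $i<j$ with $\pi_i<\pi_j$ such that, with $p_0=0,p_1=i,p_2=j,p_3=n+1$ and $v_0=0,v_1=\pi_i,v_2=\pi_j,v_3=n+1$, for every $(a,b)\in R$ there is no index $x$ with $p_a<x<p_{a+1}$ and $v_b<\pi_x<v_{b+1}$. Otherwise $\pi$ avoids it; $S_n(p)$ is the set of avoiders in $S_n$. The Eulerian polynomials $E_m(x)$ are defined by $\sum_{k\ge0}(k+1)^m x^k = E_m(x)/(1-x)^{m+1}$. -}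

module Defs where

open import Data.Nat using (ℕ; zero; suc; _+_; _*_; _∸_; _^_; _<ᵇ_; _≡ᵇ_)
open import Data.Nat.Combinatorics using (_C_)
open import Data.Bool using (Bool; true; false; _∧_; _∨_; not; if_then_else_)
open import Data.List using (List; []; _∷_; length; map; filter; concatMap; upTo; applyUpTo; sum; foldr)
import Data.List as L
open import Data.Fin using (Fin; zero; suc)
open import Data.Product using (_×_; _,_)
open import Data.Integer using (ℤ; +_; -_) renaming (_+_ to _+ℤ_; _*_ to _*ℤ_)

open import Function using (_∘_)

-- A permutation π = π₁ ⋯ πₙ of {1,…,n} is represented by its one-line word (a list of naturals).

-- 1-based access: π at position x (0 if out of range; never used out of range).
at : List ℕ → ℕ → ℕ
at []       _             = 0
at (a ∷ as) zero          = 0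
at (a ∷ as) (suc zero)    = a
at (a ∷ as) (suc (suc k)) = at as (suc k)

oneTo : ℕ → List ℕ
oneTo n = applyUpTo suc n

anyL : {A : Set} → (A → Bool) → List A → Bool
anyL p = foldr (λ a b → p a ∨ b) false

allL : {A : Set} → (A → Bool) → List A → Bool
allL p = foldr (λ a b → p a ∧ b) true

countL : {A : Set} → (A → Bool) → List A → ℕ
countL p = foldr (λ a c → if p a then suc c else c) 0

words : ℕ → ℕ → List (List ℕ)
words zero    _ = [] ∷ []
words (suc k) n = concatMap (λ a → map (a ∷_) (words k n)) (oneTo n)

-- a word of length n is a permutation of {1,…,n} iff every value 1..n occurs in it
occurs : ℕ → List ℕ → Bool
occurs v = anyL (λ a → a ≡ᵇ v)

isPerm : ℕ → List ℕ → Bool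
isPerm n w = allL (λ v → occurs v w) (oneTo n)

S : ℕ → List (List ℕ)
S n = filter (λ w → Data.Bool._≟_ (isPerm n w) true) (words n n)

des : List ℕ → ℕ
des π = countL (λ i → at π (suc i) <ᵇ at π i) (oneTo (length π ∸ 1))

-- Mesh patterns (12, R) of length 2; a shaded box is (a , b) with a b ∈ {0,1,2}.
Box : Set
Box = Fin 3 × Fin 3

-- the index/value boundaries p_0..p_3 and v_0..v_3 for an occurrence (i , j)
bnd : ℕ → ℕ → ℕ → Fin 3 → ℕ × ℕ
bnd lo i j zero          = 0 , i
bnd lo i j (suc zero)    = i , j
bnd lo i j (suc (suc _)) = j , lo

boxEmpty : List ℕ → ℕ → ℕ → Box → Bool
boxEmpty π i j (a , b) with bnd (suc (length π)) i j a | bnd (suc (length π)) (at π i) (at π j) b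
... | (pa , pa1) | (vb , vb1) =
  not (anyL (λ x → (pa <ᵇ x) ∧ (x <ᵇ pa1) ∧ (vb <ᵇ at π x) ∧ (at π x <ᵇ vb1)) (oneTo (length π)))

contains12 : List Box → List ℕ → Bool
contains12 R π =
  anyL (λ i → anyL (λ j → (i <ᵇ j) ∧ (at π i <ᵇ at π j) ∧ allL (boxEmpty π i j) R)
                   (oneTo (length π)))
       (oneTo (length π))

Av : List Box → ℕ → List (List ℕ)
Av R n = filter (λ π → Data.Bool._≟_ (contains12 R π) false) (S n)

pR : List Box
pR = (zero , suc zero) ∷ (suc zero , suc zero) ∷ (suc zero , suc (suc zero))
   ∷ (suc (suc zero) , suc zero) ∷ []

-- Eulerian polynomial E_m(x), defined by  Σ_k (k+1)^m x^k = E_m(x)/(1-x)^{m+1},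
-- i.e. E_m(x) = (1-x)^{m+1} · Σ_k (k+1)^m x^k (product of formal power series).
signed : ℕ → ℕ → ℤ
signed i a with i Data.Nat.% 2
... | zero = + a
... | _    = - (+ a)

eulerCoeff : ℕ → ℕ → ℤ
eulerCoeff m j = foldr _+ℤ_ (+ 0)
  (map (λ i → signed i (((suc m) C i) * ((suc (j ∸ i)) ^ m))) (upTo (suc j)))

xEulerCoeff : ℕ → ℕ → ℤ
xEulerCoeff m zero    = + 0
xEulerCoeff m (suc j) = eulerCoeff m j

{-# OPTIONS --safe #-}
-- Deleting the entry 1 of a permutation of {1,…,n+1} and lowering the other entries gives a
-- permutation σ of {1,…,n} and the slot s that held the 1; every pair (σ, s) arises exactly once.
-- Since 1 lies below all other values and p shades no box of the bottom row, the occurrences of p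
-- avoiding the new 1 are those of σ, while an occurrence starting at the new 1 must end at a 2
-- right next to it, so it exists iff 1 was put directly before the 1 of σ. Hence every
-- σ ∈ S_n(p) has n admissible slots and |S_{n+1}(p)| = n·|S_n(p)|. Inserting 1 adds a descent
-- unless it goes to the front or into a descent of σ, and the forbidden slot is of the latter
-- kind; so σ with d descents has d children with d descents and n − d with d + 1. This is the
-- Eulerian recurrence a(n+1,k) = k·a(n,k) + (n+1−k)·a(n,k−1), which the alternating-sum formula
-- for the coefficients of x·E_{n−1}(x) satisfies by Pascal's rule and absorption.

module Submission where

open import Defs
open import Data.Nat using (ℕ; suc; _≤_; _∸_; _≡ᵇ_)
open import Data.Nat using (_!)
open import Data.List using (length)
open import Data.Integer using (+_)
open import Data.Product using (_×_)
open import Relation.Binary.PropositionalEquality using (_≡_)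

module EulerianCoefficients where

  open import Data.Nat as ℕ using (ℕ; zero; suc; _∸_; _!; z≤n; s≤s)
  import Data.Nat.Properties as ℕ
  open import Data.Nat.Properties using (_!≢0; _!*_!≢0)
  open import Data.Nat.Combinatorics
    using (_C_; nCk+nC[k+1]≡[n+1]C[k+1]; k>n⇒nCk≡0; nCk≡n!/k![n-k]!; k![n∸k]!∣n!; [n-k]*d[k+1]≡[k+1]*d[k])
  open import Data.Nat.DivMod using (m/n*n≡m)
  open import Data.Integer using (ℤ; +_; -_; _+_; _*_; _-_; _^_)
  open import Data.Integer.Properties
    using (pos-+; pos-*; m-n≡m⊖n; ⊖-≥; neg-distrib-+; neg-involutive; -1*i≡-i;
           *-distribˡ-+; *-zeroˡ; *-zeroʳ; +-identityˡ; +-assoc; *-identityˡ; ^-zeroˡ)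
  open import Data.Integer.Tactic.RingSolver using (solve-∀)
  open import Data.List using (map; foldr; applyUpTo)
  open import Relation.Nullary using (yes; no)
  open import Data.Sum using (_⊎_; inj₁; inj₂)
  open import Relation.Binary.PropositionalEquality

  nCk*k![n∸k]!≡n! : ∀ {n k} → k ℕ.≤ n → (n C k) ℕ.* (k ! ℕ.* (n ∸ k) !) ≡ n !
  nCk*k![n∸k]!≡n! {n} {k} k≤n =
    trans (cong (ℕ._* (k ! ℕ.* (n ∸ k) !)) (nCk≡n!/k![n-k]! k≤n))
          (m/n*n≡m {{k !* (n ∸ k) !≢0}} (k![n∸k]!∣n! k≤n))

  [n∸k]*nCk≡[k+1]*nC[k+1] : ∀ n k → (n ∸ k) ℕ.* (n C k) ≡ suc k ℕ.* (n C suc k)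
  [n∸k]*nCk≡[k+1]*nC[k+1] n k with k ℕ.<? n
  ... | no k≮n = begin
    (n ∸ k) ℕ.* (n C k)      ≡⟨ cong (ℕ._* (n C k)) (ℕ.m≤n⇒m∸n≡0 (ℕ.≮⇒≥ k≮n)) ⟩
    0                      ≡⟨ ℕ.*-zeroʳ (suc k) ⟨
    suc k ℕ.* 0            ≡⟨ cong (suc k ℕ.*_) (k>n⇒nCk≡0 (s≤s (ℕ.≮⇒≥ k≮n))) ⟨
    suc k ℕ.* (n C suc k)    ∎
    where open ≡-Reasoning
  ... | yes k<n = ℕ.*-cancelʳ-≡ _ _ d[k+1] {{ℕ.m*n≢0 _ _ {{suc k !≢0}} {{(n ∸ suc k) !≢0}}}} (begin
    (n ∸ k) ℕ.* (n C k) ℕ.* d[k+1]        ≡⟨ xy∙z≈y∙xz (n ∸ k) (n C k) d[k+1] ⟩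
    (n C k) ℕ.* ((n ∸ k) ℕ.* d[k+1])      ≡⟨ cong ((n C k) ℕ.*_) ([n-k]*d[k+1]≡[k+1]*d[k] k<n) ⟩
    (n C k) ℕ.* (suc k ℕ.* d[k])          ≡⟨ x∙yz≈y∙xz (n C k) (suc k) d[k] ⟩
    suc k ℕ.* ((n C k) ℕ.* d[k])          ≡⟨ cong (suc k ℕ.*_) (nCk*k![n∸k]!≡n! (ℕ.<⇒≤ k<n)) ⟩
    suc k ℕ.* n !                       ≡⟨ cong (suc k ℕ.*_) (nCk*k![n∸k]!≡n! k<n) ⟨
    suc k ℕ.* ((n C suc k) ℕ.* d[k+1])    ≡⟨ ℕ.*-assoc (suc k) (n C suc k) d[k+1] ⟨
    suc k ℕ.* (n C suc k) ℕ.* d[k+1]      ∎)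
    where
    open ≡-Reasoning
    open import Algebra.Properties.CommutativeSemigroup ℕ.*-commutativeSemigroup using (xy∙z≈y∙xz; x∙yz≈y∙xz)
    d[k] = k ! ℕ.* (n ∸ k) !
    d[k+1] = suc k ! ℕ.* (n ∸ suc k) !

  pos-∸ : ∀ {n i} → i ℕ.≤ n → + (n ∸ i) ≡ + n - + i
  pos-∸ {n} {i} i≤n = sym (trans (m-n≡m⊖n n i) (⊖-≥ i≤n))

  pos-suc-∸ : ∀ {n i} → i ℕ.≤ n → + suc (n ∸ i) ≡ + suc n - + i
  pos-suc-∸ i≤n = trans (cong +_ (sym (ℕ.+-∸-assoc 1 i≤n))) (pos-∸ (ℕ.m≤n⇒m≤1+n i≤n))

  [n-k]*nCk≡[k+1]*nC[k+1] : ∀ n k → (+ n - + k) * + (n C k) ≡ + suc k * + (n C suc k)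
  [n-k]*nCk≡[k+1]*nC[k+1] n k with k ℕ.≤? n
  ... | yes k≤n = begin
    (+ n - + k) * + (n C k)         ≡⟨ cong (_* + (n C k)) (pos-∸ k≤n) ⟨
    + (n ∸ k) * + (n C k)           ≡⟨ pos-* (n ∸ k) (n C k) ⟨
    + ((n ∸ k) ℕ.* (n C k))         ≡⟨ cong +_ ([n∸k]*nCk≡[k+1]*nC[k+1] n k) ⟩
    + (suc k ℕ.* (n C suc k))       ≡⟨ pos-* (suc k) (n C suc k) ⟩
    + suc k * + (n C suc k)         ∎
    where open ≡-Reasoning
  ... | no k≰n = begin
    (+ n - + k) * + (n C k)         ≡⟨ cong (λ c → (+ n - + k) * + c) (k>n⇒nCk≡0 (ℕ.≰⇒> k≰n)) ⟩
    (+ n - + k) * + 0               ≡⟨ *-zeroʳ (+ n - + k) ⟩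
    + 0                             ≡⟨ *-zeroʳ (+ suc k) ⟨
    + suc k * + 0                   ≡⟨ cong (λ c → + suc k * + c) (k>n⇒nCk≡0 (ℕ.m<n⇒m<1+n (ℕ.≰⇒> k≰n))) ⟨
    + suc k * + (n C suc k)         ∎
    where open ≡-Reasoning

  ∑ : ℕ → (ℕ → ℤ) → ℤ
  ∑ zero    f = + 0
  ∑ (suc N) f = f 0 + ∑ N (λ i → f (suc i))

  ∑-cong : ∀ N {f g : ℕ → ℤ} → (∀ i → i ℕ.< N → f i ≡ g i) → ∑ N f ≡ ∑ N g
  ∑-cong zero    f≡g = refl
  ∑-cong (suc N) f≡g = cong₂ _+_ (f≡g 0 (s≤s z≤n)) (∑-cong N (λ i i<N → f≡g (suc i) (s≤s i<N)))

  ∑-neg : ∀ N (f : ℕ → ℤ) → ∑ N (λ i → - f i) ≡ - ∑ N f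
  ∑-neg zero    f = refl
  ∑-neg (suc N) f = trans (cong (_+_ (- f 0)) (∑-neg N _)) (sym (neg-distrib-+ (f 0) _))

  ∑-sub : ∀ N (f g : ℕ → ℤ) → ∑ N (λ i → f i - g i) ≡ ∑ N f - ∑ N g
  ∑-sub zero    f g = refl
  ∑-sub (suc N) f g = trans (cong (_+_ (f 0 - g 0)) (∑-sub N _ _)) (interchange (f 0) (g 0) _ _)
    where
    interchange : ∀ a b c d → (a - b) + (c - d) ≡ (a + c) - (b + d)
    interchange = solve-∀

  ∑-*ˡ : ∀ N c (f : ℕ → ℤ) → ∑ N (λ i → c * f i) ≡ c * ∑ N f
  ∑-*ˡ zero    c f = sym (*-zeroʳ c)
  ∑-*ˡ (suc N) c f = trans (cong (_+_ (c * f 0)) (∑-*ˡ N c _)) (sym (*-distribˡ-+ c (f 0) _))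

  ∑-zero : ∀ N → ∑ N (λ _ → + 0) ≡ + 0
  ∑-zero zero    = refl
  ∑-zero (suc N) = trans (+-identityˡ (∑ N (λ _ → + 0))) (∑-zero N)

  foldr-+-map-applyUpTo : ∀ N (g : ℕ → ℤ) (h : ℕ → ℕ) →
                          foldr _+_ (+ 0) (map g (applyUpTo h N)) ≡ ∑ N (λ i → g (h i))
  foldr-+-map-applyUpTo zero    g h = refl
  foldr-+-map-applyUpTo (suc N) g h = cong (_+_ (g (h 0))) (foldr-+-map-applyUpTo N g (λ i → h (suc i)))

  sign : ℕ → ℤ
  sign i = signed i 1

  signed≡sign* : ∀ i a → signed i a ≡ sign i * + a
  signed≡sign* i a with i ℕ.% 2
  ... | zero  = sym (*-identityˡ (+ a))
  ... | suc _ = sym (-1*i≡-i (+ a))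

  sign-suc : ∀ i → sign (suc i) ≡ - sign i
  sign-suc zero    = refl
  sign-suc (suc i) = sym (trans (cong -_ (sign-suc i)) (neg-involutive (sign i)))

  pos-^ : ∀ a p → + (a ℕ.^ p) ≡ (+ a) ^ p
  pos-^ a zero    = refl
  pos-^ a (suc p) = trans (pos-* a (a ℕ.^ p)) (cong (+ a *_) (pos-^ a p))

  eulerTerm : ℕ → ℕ → ℕ → ℕ → ℤ
  eulerTerm p K j i = sign i * (+ (K C i) * (+ suc (j ∸ i)) ^ p)

  eulerSum : ℕ → ℕ → ℕ → ℤ
  eulerSum p K j = ∑ (suc j) (eulerTerm p K j)

  eulerCoeff≡eulerSum : ∀ m j → eulerCoeff m j ≡ eulerSum m (suc m) j
  eulerCoeff≡eulerSum m j =
    trans (foldr-+-map-applyUpTo (suc j) (λ i → signed i ((suc m C i) ℕ.* suc (j ∸ i) ℕ.^ m)) (λ i → i))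
          (∑-cong (suc j) (λ i _ → term≡eulerTerm i))
    where
    term≡eulerTerm : ∀ i → signed i ((suc m C i) ℕ.* suc (j ∸ i) ℕ.^ m) ≡ eulerTerm m (suc m) j i
    term≡eulerTerm i = trans (signed≡sign* i _)
      (cong (sign i *_) (trans (pos-* (suc m C i) _) (cong (+ (suc m C i) *_) (pos-^ (suc (j ∸ i)) m))))

  eulerTerm-pascal : ∀ p K j i →
    eulerTerm p (suc K) (suc j) (suc i) ≡ eulerTerm p K (suc j) (suc i) - eulerTerm p K j i
  eulerTerm-pascal p K j i = begin
    sign (suc i) * (+ (suc K C suc i) * y)
      ≡⟨ cong₂ (λ s c → s * (c * y)) (sign-suc i)
           (trans (cong +_ (sym (nCk+nC[k+1]≡[n+1]C[k+1] K i))) (pos-+ (K C i) (K C suc i))) ⟩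
    - sign i * ((+ (K C i) + + (K C suc i)) * y)
      ≡⟨ distrib (sign i) (+ (K C i)) (+ (K C suc i)) y ⟩
    - sign i * (+ (K C suc i) * y) - sign i * (+ (K C i) * y)
      ≡⟨ cong (λ s → s * (+ (K C suc i) * y) - sign i * (+ (K C i) * y)) (sign-suc i) ⟨
    sign (suc i) * (+ (K C suc i) * y) - sign i * (+ (K C i) * y)   ∎
    where
    open ≡-Reasoning
    y = (+ suc (j ∸ i)) ^ p
    distrib : ∀ s a b y → - s * ((a + b) * y) ≡ - s * (b * y) - s * (a * y)
    distrib = solve-∀

  eulerSum-pascal : ∀ p K j → eulerSum p (suc K) (suc j) ≡ eulerSum p K (suc j) - eulerSum p K j
  eulerSum-pascal p K j = begin
    eulerSum p (suc K) (suc j)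
      ≡⟨ cong (_+_ t₀) (∑-cong (suc j) (λ i _ → eulerTerm-pascal p K j i)) ⟩
    t₀ + ∑ (suc j) (λ i → eulerTerm p K (suc j) (suc i) - eulerTerm p K j i)
      ≡⟨ cong (_+_ t₀) (∑-sub (suc j) (λ i → eulerTerm p K (suc j) (suc i)) (eulerTerm p K j)) ⟩
    t₀ + (∑ (suc j) (λ i → eulerTerm p K (suc j) (suc i)) - eulerSum p K j)
      ≡⟨ +-assoc t₀ (∑ (suc j) (λ i → eulerTerm p K (suc j) (suc i))) (- eulerSum p K j) ⟨
    eulerSum p K (suc j) - eulerSum p K j   ∎
    where
    open ≡-Reasoning
    t₀ = eulerTerm p K (suc j) 0

  shiftedTerm : ℕ → ℕ → ℕ → ℤ
  shiftedTerm m j i = sign i * ((+ suc i * + (suc m C suc i)) * (+ suc (j ∸ i)) ^ m)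

  shiftedSum : ℕ → ℕ → ℤ
  shiftedSum m j = ∑ (suc j) (shiftedTerm m j)

  -- Both expansions peel one factor J+1−i off the (m+1)-st power (J the summation bound): as
  -- (J+1) − i, resp. as (m+1−i) − (m−J) followed by absorption (m+1−i)·C(m+1,i) = (i+1)·C(m+1,i+1).
  -- Either way the remainder is ± shiftedSum.
  eulerSum-upper : ∀ m j →
    eulerSum (suc m) (suc m) (suc j) ≡ + suc (suc j) * eulerSum m (suc m) (suc j) + shiftedSum m j
  eulerSum-upper m j = begin
    eulerSum (suc m) (suc m) n
      ≡⟨ ∑-cong (suc n) split ⟩
    ∑ (suc n) (λ i → + suc n * eulerTerm m (suc m) n i - r i)
      ≡⟨ ∑-sub (suc n) (λ i → + suc n * eulerTerm m (suc m) n i) r ⟩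
    ∑ (suc n) (λ i → + suc n * eulerTerm m (suc m) n i) - ∑ (suc n) r
      ≡⟨ cong₂ _-_ (∑-*ˡ (suc n) (+ suc n) (eulerTerm m (suc m) n)) ∑r≡-shiftedSum ⟩
    + suc n * eulerSum m (suc m) n - - shiftedSum m j
      ≡⟨ cong (_+_ (+ suc n * eulerSum m (suc m) n)) (neg-involutive (shiftedSum m j)) ⟩
    + suc n * eulerSum m (suc m) n + shiftedSum m j   ∎
    where
    open ≡-Reasoning
    n = suc j
    r : ℕ → ℤ
    r i = sign i * (+ i * (+ (suc m C i) * (+ suc (n ∸ i)) ^ m))
    split : ∀ i → i ℕ.< suc n → eulerTerm (suc m) (suc m) n i ≡ + suc n * eulerTerm m (suc m) n i - r i
    split i (s≤s i≤n) = begin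
      sign i * (+ (suc m C i) * (+ suc (n ∸ i) * y))
        ≡⟨ cong (λ a → sign i * (+ (suc m C i) * (a * y))) (pos-suc-∸ i≤n) ⟩
      sign i * (+ (suc m C i) * ((+ suc n - + i) * y))
        ≡⟨ expand (sign i) (+ (suc m C i)) (+ suc n) (+ i) y ⟩
      + suc n * (sign i * (+ (suc m C i) * y)) - sign i * (+ i * (+ (suc m C i) * y))   ∎
      where
      y = (+ suc (n ∸ i)) ^ m
      expand : ∀ s c a b y → s * (c * ((a - b) * y)) ≡ a * (s * (c * y)) - s * (b * (c * y))
      expand = solve-∀
    r-suc : ∀ i → r (suc i) ≡ - shiftedTerm m j i
    r-suc i = trans (cong (λ s → s * (+ suc i * (+ (suc m C suc i) * y))) (sign-suc i))
                    (reassoc (sign i) (+ suc i) (+ (suc m C suc i)) y)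
      where
      y = (+ suc (j ∸ i)) ^ m
      reassoc : ∀ s a c y → - s * (a * (c * y)) ≡ - (s * ((a * c) * y))
      reassoc = solve-∀
    ∑r≡-shiftedSum : ∑ (suc n) r ≡ - shiftedSum m j
    ∑r≡-shiftedSum = begin
      r 0 + ∑ n (λ i → r (suc i))
        ≡⟨ cong (_+ ∑ n (λ i → r (suc i))) (cong (sign 0 *_) (*-zeroˡ (+ (suc m C 0) * (+ suc n) ^ m))) ⟩
      + 0 + ∑ n (λ i → r (suc i))
        ≡⟨ +-identityˡ (∑ n (λ i → r (suc i))) ⟩
      ∑ n (λ i → r (suc i))
        ≡⟨ ∑-cong n (λ i _ → r-suc i) ⟩
      ∑ n (λ i → - shiftedTerm m j i)
        ≡⟨ ∑-neg n (shiftedTerm m j) ⟩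
      - shiftedSum m j ∎

  eulerSum-lower : ∀ m j →
    eulerSum (suc m) (suc m) j ≡ shiftedSum m j - (+ suc m - + suc j) * eulerSum m (suc m) j
  eulerSum-lower m j = begin
    eulerSum (suc m) (suc m) j
      ≡⟨ ∑-cong (suc j) split ⟩
    ∑ (suc j) (λ i → q i - (+ suc m - + suc j) * eulerTerm m (suc m) j i)
      ≡⟨ ∑-sub (suc j) q (λ i → (+ suc m - + suc j) * eulerTerm m (suc m) j i) ⟩
    shiftedSum m j - ∑ (suc j) (λ i → (+ suc m - + suc j) * eulerTerm m (suc m) j i)
      ≡⟨ cong (_-_ (shiftedSum m j)) (∑-*ˡ (suc j) (+ suc m - + suc j) (eulerTerm m (suc m) j)) ⟩
    shiftedSum m j - (+ suc m - + suc j) * eulerSum m (suc m) j   ∎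
    where
    open ≡-Reasoning
    q = shiftedTerm m j
    split : ∀ i → i ℕ.< suc j → eulerTerm (suc m) (suc m) j i ≡ q i - (+ suc m - + suc j) * eulerTerm m (suc m) j i
    split i (s≤s i≤j) = begin
      sign i * (+ (suc m C i) * (+ suc (j ∸ i) * y))
        ≡⟨ cong (λ a → sign i * (+ (suc m C i) * (a * y))) (pos-suc-∸ i≤j) ⟩
      sign i * (+ (suc m C i) * ((+ suc j - + i) * y))
        ≡⟨ expand (sign i) (+ (suc m C i)) (+ suc m) (+ suc j) (+ i) y ⟩
      sign i * (((+ suc m - + i) * + (suc m C i)) * y) - (+ suc m - + suc j) * (sign i * (+ (suc m C i) * y))
        ≡⟨ cong (λ a → sign i * (a * y) - (+ suc m - + suc j) * eulerTerm m (suc m) j i)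
                ([n-k]*nCk≡[k+1]*nC[k+1] (suc m) i) ⟩
      q i - (+ suc m - + suc j) * eulerTerm m (suc m) j i   ∎
      where
      y = (+ suc (j ∸ i)) ^ m
      expand : ∀ s c a b i y → s * (c * ((b - i) * y)) ≡ s * (((a - i) * c) * y) - (a - b) * (s * (c * y))
      expand = solve-∀

  eulerCoeff-rec : ∀ m j → eulerCoeff (suc m) (suc j) ≡
    + suc (suc j) * eulerCoeff m (suc j) + (+ suc m - + suc j) * eulerCoeff m j
  eulerCoeff-rec m j = begin
    eulerCoeff (suc m) (suc j)
      ≡⟨ eulerCoeff≡eulerSum (suc m) (suc j) ⟩
    eulerSum (suc m) (suc (suc m)) (suc j)
      ≡⟨ eulerSum-pascal (suc m) (suc m) j ⟩
    eulerSum (suc m) (suc m) (suc j) - eulerSum (suc m) (suc m) j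
      ≡⟨ cong₂ _-_ (eulerSum-upper m j) (eulerSum-lower m j) ⟩
    (a * E₁ + shiftedSum m j) - (shiftedSum m j - b * E₀)
      ≡⟨ cancel a E₁ (shiftedSum m j) b E₀ ⟩
    a * E₁ + b * E₀
      ≡⟨ cong₂ (λ e₁ e₀ → a * e₁ + b * e₀) (eulerCoeff≡eulerSum m (suc j)) (eulerCoeff≡eulerSum m j) ⟨
    a * eulerCoeff m (suc j) + b * eulerCoeff m j   ∎
    where
    open ≡-Reasoning
    a = + suc (suc j)
    b = + suc m - + suc j
    E₁ = eulerSum m (suc m) (suc j)
    E₀ = eulerSum m (suc m) j
    cancel : ∀ a e₁ d b e₀ → (a * e₁ + d) - (d - b * e₀) ≡ a * e₁ + b * e₀
    cancel = solve-∀

  eulerCoeff-0 : ∀ m → eulerCoeff m 0 ≡ + 1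
  eulerCoeff-0 m = trans (eulerCoeff≡eulerSum m 0) (cong (λ a → + 1 * (+ 1 * a) + + 0) (^-zeroˡ m))

  eulerSum-0-0 : ∀ j → eulerSum 0 0 j ≡ + 1
  eulerSum-0-0 j = cong (_+_ (+ 1)) (trans (∑-cong j (λ i _ → *-zeroʳ (sign (suc i)))) (∑-zero j))

  eulerCoeff-0-suc : ∀ j → eulerCoeff 0 (suc j) ≡ + 0
  eulerCoeff-0-suc j = begin
    eulerCoeff 0 (suc j)                  ≡⟨ eulerCoeff≡eulerSum 0 (suc j) ⟩
    eulerSum 0 1 (suc j)                  ≡⟨ eulerSum-pascal 0 0 j ⟩
    eulerSum 0 0 (suc j) - eulerSum 0 0 j ≡⟨ cong₂ _-_ (eulerSum-0-0 (suc j)) (eulerSum-0-0 j) ⟩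
    + 0                                   ∎
    where open ≡-Reasoning

  eulerCoeff-1-suc : ∀ j → eulerCoeff 1 (suc j) ≡ + 0
  eulerCoeff-1-suc j = begin
    eulerCoeff 1 (suc j)
      ≡⟨ eulerCoeff-rec 0 j ⟩
    + suc (suc j) * eulerCoeff 0 (suc j) + (+ 1 - + suc j) * eulerCoeff 0 j
      ≡⟨ cong₂ _+_ (trans (cong (+ suc (suc j) *_) (eulerCoeff-0-suc j)) (*-zeroʳ (+ suc (suc j)))) (lower j) ⟩
    + 0   ∎
    where
    open ≡-Reasoning
    lower : ∀ j → (+ 1 - + suc j) * eulerCoeff 0 j ≡ + 0
    lower zero    = refl
    lower (suc j) = trans (cong ((+ 1 - + suc (suc j)) *_) (eulerCoeff-0-suc j)) (*-zeroʳ (+ 1 - + suc (suc j)))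

  xEulerCoeff-rec : ∀ m k → xEulerCoeff (suc m) (suc k) ≡
    + suc k * xEulerCoeff m (suc k) + (+ suc m - + k) * xEulerCoeff m k
  xEulerCoeff-rec m zero    = begin
    eulerCoeff (suc m) 0                         ≡⟨ eulerCoeff-0 (suc m) ⟩
    + 1                                          ≡⟨ cong (λ e → e + + 0) (eulerCoeff-0 m) ⟨
    eulerCoeff m 0 + + 0                         ≡⟨ cong₂ _+_ (*-identityˡ (eulerCoeff m 0)) (*-zeroʳ (+ suc m - + 0)) ⟨
    + 1 * eulerCoeff m 0 + (+ suc m - + 0) * + 0 ∎
    where open ≡-Reasoning
  xEulerCoeff-rec m (suc j) = eulerCoeff-rec m j

  -- The disjunction accounts for truncated subtraction: for k > m+1 the factor m+1 ∸ k is 0 while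
  -- + suc m - + k is not.
  pos-xEulerCoeff-rec : ∀ m k a b → + a ≡ xEulerCoeff m (suc k) → + b ≡ xEulerCoeff m k → k ℕ.≤ suc m ⊎ b ≡ 0 →
    + (suc k ℕ.* a ℕ.+ (suc m ∸ k) ℕ.* b) ≡ xEulerCoeff (suc m) (suc k)
  pos-xEulerCoeff-rec m k a b a≡ b≡ k≤∨b≡0 = begin
    + (suc k ℕ.* a ℕ.+ (suc m ∸ k) ℕ.* b)               ≡⟨ pos-+ (suc k ℕ.* a) _ ⟩
    + (suc k ℕ.* a) + + ((suc m ∸ k) ℕ.* b)             ≡⟨ cong₂ _+_ (pos-* (suc k) a) (truncated k≤∨b≡0) ⟩
    + suc k * + a + (+ suc m - + k) * + b               ≡⟨ cong₂ (λ x y → + suc k * x + (+ suc m - + k) * y) a≡ b≡ ⟩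
    + suc k * xEulerCoeff m (suc k) + (+ suc m - + k) * xEulerCoeff m k ≡⟨ xEulerCoeff-rec m k ⟨
    xEulerCoeff (suc m) (suc k)                         ∎
    where
    open ≡-Reasoning
    truncated : k ℕ.≤ suc m ⊎ b ≡ 0 → + ((suc m ∸ k) ℕ.* b) ≡ (+ suc m - + k) * + b
    truncated (inj₁ k≤) = trans (pos-* (suc m ∸ k) b) (cong (_* + b) (pos-∸ k≤))
    truncated (inj₂ refl) = trans (cong +_ (ℕ.*-zeroʳ (suc m ∸ k))) (sym (*-zeroʳ (+ suc m - + k)))

open EulerianCoefficients using (pos-xEulerCoeff-rec; eulerCoeff-1-suc)

open import Data.Nat
open import Data.Nat.Properties
open import Data.Bool using (Bool; true; false; T; not; _∧_; _∨_; if_then_else_)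
import Data.Bool as Bool
open import Data.Bool.Properties using (T-∧; T-∨; T-≡; T-not-≡; ∨-identityʳ; ∧-zeroʳ; if-float; if-eta)
open import Data.Unit using (tt)
open import Data.Fin as Fin using (Fin)
open import Data.Empty using (⊥; ⊥-elim)
open import Data.Product using (∃; ∃₂; _×_; _,_; proj₁; proj₂; uncurry)
open import Data.Sum using (_⊎_; inj₁; inj₂)
open import Data.List using (List; []; _∷_; _++_; length; map; concatMap; upTo; applyUpTo; filter; cartesianProductWith)
open import Data.Nat.ListAction using (sum)
open import Data.List.Properties using (length-map; length-++; length-applyUpTo; applyUpTo-∷ʳ; ∷-injective; map-∘; map-id; map-id-local)
open import Data.List.Membership.Propositional using (_∈_; find)
open import Data.List.Membership.Propositional.Properties
  using (∈-map⁺; ∈-map⁻; ∈-concatMap⁺; ∈-concatMap⁻; ∈-applyUpTo⁺; ∈-applyUpTo⁻; ∈-upTo⁺; ∈-upTo⁻;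
         ∈-filter⁺; ∈-filter⁻; ∈-∃++; ∈-cartesianProductWith⁺; ∈-cartesianProductWith⁻)
open import Data.List.Membership.Propositional.Properties.WithK using (unique∧set⇒bag)
open import Data.List.Relation.Unary.Any using (here; there)
import Data.List.Relation.Unary.Any as Any
open import Data.List.Relation.Unary.All using (All; []; _∷_)
import Data.List.Relation.Unary.All as All
open import Data.List.Relation.Unary.All.Properties using () renaming (map⁺ to All-map⁺)
open import Data.List.Relation.Unary.AllPairs using ([]; _∷_)
open import Data.List.Relation.Unary.Unique.Propositional using (Unique)
import Data.List.Relation.Unary.Unique.Propositional.Properties as Unique
open import Data.List.Relation.Binary.Permutation.Propositional as ↭ using (_↭_)
open import Data.List.Relation.Binary.Permutation.Propositional.Properties using (↭-length)
open import Data.Nat.Tactic.RingSolver using (solve-∀)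
open import Data.List.Relation.Binary.BagAndSetEquality using (∼bag⇒↭)
open import Function using (_∘_; Equivalence; mk⇔; case_of_)
open import Relation.Nullary using (¬_; yes; no)
open import Relation.Binary.Definitions using (Tri; tri<; tri≈; tri>)
open import Relation.Nullary.Decidable using (T?)
open import Relation.Binary.PropositionalEquality
  using (_≡_; _≢_; refl; sym; trans; cong; cong₂; subst; subst₂; module ≡-Reasoning)

private
  variable
    A B : Set

T⇒≡true : ∀ {b} → T b → b ≡ true
T⇒≡true = Equivalence.to T-≡

¬T⇒≡false : ∀ {b} → ¬ T b → b ≡ false
¬T⇒≡false {false} _  = refl
¬T⇒≡false {true}  ¬t = ⊥-elim (¬t tt)

T-∧⁻ : ∀ {a b} → T (a ∧ b) → T a × T b
T-∧⁻ = Equivalence.to T-∧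

T-∧⁺ : ∀ {a b} → T a → T b → T (a ∧ b)
T-∧⁺ ta tb = Equivalence.from T-∧ (ta , tb)

T-∨⁻ : ∀ {a b} → T (a ∨ b) → T a ⊎ T b
T-∨⁻ = Equivalence.to T-∨

T-∨⁺ˡ : ∀ {a b} → T a → T (a ∨ b)
T-∨⁺ˡ ta = Equivalence.from T-∨ (inj₁ ta)

T-∨⁺ʳ : ∀ {a b} → T b → T (a ∨ b)
T-∨⁺ʳ tb = Equivalence.from T-∨ (inj₂ tb)

T-not⁺ : ∀ {a} → ¬ T a → T (not a)
T-not⁺ ¬ta = Equivalence.from T-not-≡ (¬T⇒≡false ¬ta)

T-not⁻ : ∀ {a} → T (not a) → ¬ T a
T-not⁻ {true} ()

T⇔T⇒≡ : ∀ {a b} → (T a → T b) → (T b → T a) → a ≡ b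
T⇔T⇒≡ {false} {false} _ _ = refl
T⇔T⇒≡ {false} {true}  _ g = ⊥-elim (g tt)
T⇔T⇒≡ {true}  {false} f _ = ⊥-elim (f tt)
T⇔T⇒≡ {true}  {true}  _ _ = refl

anyL⁺ : ∀ (p : A → Bool) {x xs} → x ∈ xs → T (p x) → T (anyL p xs)
anyL⁺ p (here refl) t = T-∨⁺ˡ t
anyL⁺ p (there x∈)  t = T-∨⁺ʳ (anyL⁺ p x∈ t)

anyL⁻ : ∀ (p : A → Bool) xs → T (anyL p xs) → ∃ λ x → x ∈ xs × T (p x)
anyL⁻ p (y ∷ xs) t with T-∨⁻ {p y} t
... | inj₁ t′ = y , here refl , t′
... | inj₂ t′ with anyL⁻ p xs t′
...   | x , x∈ , tx = x , there x∈ , tx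

allL⁺ : ∀ (p : A → Bool) xs → (∀ {x} → x ∈ xs → T (p x)) → T (allL p xs)
allL⁺ p []       _ = tt
allL⁺ p (y ∷ xs) f = T-∧⁺ (f (here refl)) (allL⁺ p xs (f ∘ there))

allL⁻ : ∀ (p : A → Bool) xs → T (allL p xs) → ∀ {x} → x ∈ xs → T (p x)
allL⁻ p (y ∷ xs) t (here refl) = proj₁ (T-∧⁻ {p y} t)
allL⁻ p (y ∷ xs) t (there x∈)  = allL⁻ p xs (proj₂ (T-∧⁻ {p y} t)) x∈

anyL-cong : ∀ {p q : A → Bool} xs → (∀ {x} → x ∈ xs → p x ≡ q x) → anyL p xs ≡ anyL q xs
anyL-cong []       _   = refl
anyL-cong (y ∷ xs) p≡q = cong₂ _∨_ (p≡q (here refl)) (anyL-cong xs (p≡q ∘ there))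

allL-cong : ∀ {p q : A → Bool} xs → (∀ {x} → x ∈ xs → p x ≡ q x) → allL p xs ≡ allL q xs
allL-cong []       _   = refl
allL-cong (y ∷ xs) p≡q = cong₂ _∧_ (p≡q (here refl)) (allL-cong xs (p≡q ∘ there))

countL-cong : ∀ {p q : A → Bool} xs → (∀ {x} → x ∈ xs → p x ≡ q x) → countL p xs ≡ countL q xs
countL-cong []       _   = refl
countL-cong (y ∷ xs) p≡q rewrite p≡q (here refl) | countL-cong xs (p≡q ∘ there) = refl

countL-≡0 : ∀ (p : A → Bool) xs → (∀ {x} → x ∈ xs → p x ≡ false) → countL p xs ≡ 0
countL-≡0 p []       _  = refl
countL-≡0 p (y ∷ xs) ¬p rewrite ¬p (here refl) = countL-≡0 p xs (¬p ∘ there)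

countL-≤-length : ∀ (p : A → Bool) xs → countL p xs ≤ length xs
countL-≤-length p []       = z≤n
countL-≤-length p (x ∷ xs) with p x
... | true  = s≤s (countL-≤-length p xs)
... | false = m≤n⇒m≤1+n (countL-≤-length p xs)

countL-true : ∀ (xs : List A) → countL (λ _ → true) xs ≡ length xs
countL-true []       = refl
countL-true (x ∷ xs) = cong suc (countL-true xs)

countL-not : ∀ (p : A → Bool) xs → countL (not ∘ p) xs + countL p xs ≡ length xs
countL-not p []       = refl
countL-not p (x ∷ xs) with p x
... | true  = trans (+-suc _ _) (cong suc (countL-not p xs))
... | false = cong suc (countL-not p xs)

countL-map : ∀ (p : B → Bool) (f : A → B) xs → countL p (map f xs) ≡ countL (p ∘ f) xs
countL-map p f []       = refl
countL-map p f (x ∷ xs) rewrite countL-map p f xs = refl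

countL-++ : ∀ (p : A → Bool) xs ys → countL p (xs ++ ys) ≡ countL p xs + countL p ys
countL-++ p []       ys = refl
countL-++ p (x ∷ xs) ys with p x
... | true  = cong suc (countL-++ p xs ys)
... | false = countL-++ p xs ys

countL-concatMap : ∀ (p : B → Bool) (f : A → List B) xs →
                   countL p (concatMap f xs) ≡ sum (map (countL p ∘ f) xs)
countL-concatMap p f []       = refl
countL-concatMap p f (x ∷ xs) =
  trans (countL-++ p (f x) (concatMap f xs)) (cong (_+_ (countL p (f x))) (countL-concatMap p f xs))

countL-filter : ∀ (p q : A → Bool) xs →
                countL q (filter (T? ∘ not ∘ p) xs) + countL (λ x → q x ∧ p x) xs ≡ countL q xs
countL-filter p q []       = refl
countL-filter p q (x ∷ xs) with p x
... | false with q x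
...   | true  = cong suc (countL-filter p q xs)
...   | false = countL-filter p q xs
countL-filter p q (x ∷ xs) | true with q x
...   | true  = trans (+-suc _ _) (cong suc (countL-filter p q xs))
...   | false = countL-filter p q xs

countL-if : ∀ (r : A → Bool) a b xs → countL (λ x → if r x then a else b) xs ≡
            (if b then countL (not ∘ r) xs else 0) + (if a then countL r xs else 0)
countL-if r a b []       = sym (cong₂ _+_ (if-eta b) (if-eta a))
countL-if r a b (x ∷ xs) with r x
... | true  with a
...   | true  = trans (cong suc (countL-if r true b xs)) (sym (+-suc _ _))
...   | false = countL-if r false b xs
countL-if r a b (x ∷ xs) | false with b
...   | true  = cong suc (countL-if r a true xs)
...   | false = countL-if r a false xs

countL-↭ : ∀ (p : A → Bool) {xs ys} → xs ↭ ys → countL p xs ≡ countL p ys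
countL-↭ p ↭.refl             = refl
countL-↭ p (↭.prep x xs↭ys)   rewrite countL-↭ p xs↭ys = refl
countL-↭ p (↭.swap x y xs↭ys) with p x | p y
... | true  | true  rewrite countL-↭ p xs↭ys = refl
... | true  | false rewrite countL-↭ p xs↭ys = refl
... | false | true  rewrite countL-↭ p xs↭ys = refl
... | false | false rewrite countL-↭ p xs↭ys = refl
countL-↭ p (↭.trans xs↭ys ys↭zs) = trans (countL-↭ p xs↭ys) (countL-↭ p ys↭zs)

unique∧sameElements⇒↭ : ∀ {xs ys : List A} → Unique xs → Unique ys →
                        (∀ {z} → z ∈ xs → z ∈ ys) → (∀ {z} → z ∈ ys → z ∈ xs) → xs ↭ ys
unique∧sameElements⇒↭ ux uy xs⊆ys ys⊆xs = ∼bag⇒↭ (unique∧set⇒bag ux uy (mk⇔ xs⊆ys ys⊆xs))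

∈-oneTo⁺ : ∀ {x n} → 1 ≤ x → x ≤ n → x ∈ oneTo n
∈-oneTo⁺ {suc x} (s≤s _) x≤n = ∈-applyUpTo⁺ suc x≤n

∈-oneTo⁻ : ∀ {x n} → x ∈ oneTo n → 1 ≤ x × x ≤ n
∈-oneTo⁻ x∈ with ∈-applyUpTo⁻ suc x∈
... | i , i<n , refl = s≤s z≤n , i<n

oneTo-unique : ∀ n → Unique (oneTo n)
oneTo-unique n = Unique.applyUpTo⁺₁ suc n (λ i<j _ eq → <-irrefl (suc-injective eq) i<j)

at-∈ : ∀ xs {y} → 1 ≤ y → y ≤ length xs → at xs y ∈ xs
at-∈ (a ∷ xs) {suc zero}    _ _         = here refl
at-∈ (a ∷ xs) {suc (suc y)} _ (s≤s y≤) = there (at-∈ xs (s≤s z≤n) y≤)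

∈⇒at : ∀ {v} xs → v ∈ xs → ∃ λ y → 1 ≤ y × y ≤ length xs × at xs y ≡ v
∈⇒at (a ∷ xs) (here refl) = 1 , s≤s z≤n , s≤s z≤n , refl
∈⇒at (a ∷ xs) (there v∈) with ∈⇒at xs v∈
... | suc y , _ , y≤ , eq = suc (suc y) , s≤s z≤n , s≤s y≤ , eq

at-map : ∀ (f : ℕ → ℕ) xs {y} → 1 ≤ y → y ≤ length xs → at (map f xs) y ≡ f (at xs y)
at-map f (a ∷ xs) {suc zero}    _ _        = refl
at-map f (a ∷ xs) {suc (suc y)} _ (s≤s y≤) = at-map f xs (s≤s z≤n) y≤

at-beyond : ∀ xs {y} → length xs < y → at xs y ≡ 0
at-beyond []       _ = refl
at-beyond (a ∷ xs) {suc (suc y)} (s≤s len<) = at-beyond xs len<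

-- Permutations as words

words-suc : ∀ k n → words (suc k) n ≡ cartesianProductWith _∷_ (oneTo n) (words k n)
words-suc k n = go (oneTo n)
  where
  go : ∀ as → concatMap (λ a → map (a ∷_) (words k n)) as ≡ cartesianProductWith _∷_ as (words k n)
  go []       = refl
  go (a ∷ as) = cong (map (a ∷_) (words k n) ++_) (go as)

∈-words⁺ : ∀ {n} w → All (_∈ oneTo n) w → w ∈ words (length w) n
∈-words⁺         []      []          = here refl
∈-words⁺ {n} (a ∷ w) (a∈ ∷ w⊆) rewrite words-suc (length w) n =
  ∈-cartesianProductWith⁺ _∷_ a∈ (∈-words⁺ w w⊆)

∈-words⁻ : ∀ k n {w} → w ∈ words k n → length w ≡ k × All (_∈ oneTo n) w
∈-words⁻ zero    n (here refl) = refl , []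
∈-words⁻ (suc k) n w∈ rewrite words-suc k n
  with _ , w′ , a∈ , w′∈ , refl ← ∈-cartesianProductWith⁻ _∷_ (oneTo n) (words k n) w∈
  with len , w′⊆ ← ∈-words⁻ k n w′∈ = cong suc len , a∈ ∷ w′⊆

words-unique : ∀ k n → Unique (words k n)
words-unique zero    n = [] ∷ []
words-unique (suc k) n rewrite words-suc k n =
  Unique.cartesianProductWith⁺ _∷_ ∷-injective (oneTo-unique n) (words-unique k n)

record IsPerm (n : ℕ) (π : List ℕ) : Set where
  field
    length≡ : length π ≡ n
    ⊆oneTo  : All (_∈ oneTo n) π
    oneTo⊆  : ∀ {v} → v ∈ oneTo n → v ∈ π

∈⇒occurs : ∀ {v w} → v ∈ w → T (occurs v w)
∈⇒occurs {v} v∈ = anyL⁺ (_≡ᵇ v) v∈ (≡⇒≡ᵇ v v refl)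

occurs⇒∈ : ∀ {v} w → T (occurs v w) → v ∈ w
occurs⇒∈ {v} w t with anyL⁻ (_≡ᵇ v) w t
... | a , a∈ , a≡ᵇv rewrite ≡ᵇ⇒≡ a v a≡ᵇv = a∈

isPerm⁺ : ∀ n w → (∀ {v} → v ∈ oneTo n → v ∈ w) → T (isPerm n w)
isPerm⁺ n w ⊆w = allL⁺ (λ v → occurs v w) (oneTo n) (∈⇒occurs ∘ ⊆w)

isPerm⁻ : ∀ n w → T (isPerm n w) → ∀ {v} → v ∈ oneTo n → v ∈ w
isPerm⁻ n w t v∈ = occurs⇒∈ w (allL⁻ (λ v → occurs v w) (oneTo n) t v∈)

IsPerm⇒∈S : ∀ {n π} → IsPerm n π → π ∈ S n
IsPerm⇒∈S {n} {π} p = ∈-filter⁺ (λ w → isPerm n w Bool.≟ true)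
  (subst (λ k → π ∈ words k n) length≡ (∈-words⁺ π ⊆oneTo))
  (T⇒≡true (isPerm⁺ n π oneTo⊆))
  where open IsPerm p

∈S⇒IsPerm : ∀ {n π} → π ∈ S n → IsPerm n π
∈S⇒IsPerm {n} {π} π∈
  with π∈words , isPerm≡true ← ∈-filter⁻ (λ w → isPerm n w Bool.≟ true) {xs = words n n} π∈
  with len , ⊆oneTo ← ∈-words⁻ n n π∈words =
  record { length≡ = len ; ⊆oneTo = ⊆oneTo ; oneTo⊆ = isPerm⁻ n π (subst T (sym isPerm≡true) tt) }

S-unique : ∀ n → Unique (S n)
S-unique n = Unique.filter⁺ (λ w → isPerm n w Bool.≟ true) (words-unique n n)

∈Av⁺ : ∀ R n {π} → IsPerm n π → contains12 R π ≡ false → π ∈ Av R n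
∈Av⁺ R n p avoids = ∈-filter⁺ (λ π → contains12 R π Bool.≟ false) (IsPerm⇒∈S p) avoids

∈Av⁻ : ∀ R n {π} → π ∈ Av R n → IsPerm n π × contains12 R π ≡ false
∈Av⁻ R n π∈ with π∈S , avoids ← ∈-filter⁻ (λ π → contains12 R π Bool.≟ false) {xs = S n} π∈ =
  ∈S⇒IsPerm π∈S , avoids

Av-unique : ∀ R n → Unique (Av R n)
Av-unique R n = Unique.filter⁺ (λ π → contains12 R π Bool.≟ false) (S-unique n)

-- Inserting a new minimum

insAt : ℕ → ℕ → List ℕ → List ℕ
insAt zero    e xs       = e ∷ xs
insAt (suc s) e []       = e ∷ []
insAt (suc s) e (x ∷ xs) = x ∷ insAt s e xs

insertOne : ℕ → List ℕ → List ℕ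
insertOne s σ = insAt s 1 (map suc σ)

length-insAt : ∀ s e τ → s ≤ length τ → length (insAt s e τ) ≡ suc (length τ)
length-insAt zero    e τ       _        = refl
length-insAt (suc s) e (x ∷ τ) (s≤s s≤) = cong suc (length-insAt s e τ s≤)

insAt-++ : ∀ e α β → insAt (length α) e (α ++ β) ≡ α ++ e ∷ β
insAt-++ e []      β = refl
insAt-++ e (a ∷ α) β = cong (a ∷_) (insAt-++ e α β)

∈-insAt⁺ˡ : ∀ s e τ → e ∈ insAt s e τ
∈-insAt⁺ˡ zero    e τ       = here refl
∈-insAt⁺ˡ (suc s) e []      = here refl
∈-insAt⁺ˡ (suc s) e (x ∷ τ) = there (∈-insAt⁺ˡ s e τ)

∈-insAt⁺ʳ : ∀ s e {τ x} → x ∈ τ → x ∈ insAt s e τ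
∈-insAt⁺ʳ zero    e x∈               = there x∈
∈-insAt⁺ʳ (suc s) e {y ∷ τ} (here refl) = here refl
∈-insAt⁺ʳ (suc s) e {y ∷ τ} (there x∈)  = there (∈-insAt⁺ʳ s e x∈)

∈-insAt⁻ : ∀ s e τ {x} → x ∈ insAt s e τ → x ≡ e ⊎ x ∈ τ
∈-insAt⁻ zero    e τ       (here refl) = inj₁ refl
∈-insAt⁻ zero    e τ       (there x∈)  = inj₂ x∈
∈-insAt⁻ (suc s) e []      (here refl) = inj₁ refl
∈-insAt⁻ (suc s) e (y ∷ τ) (here refl) = inj₂ (here refl)
∈-insAt⁻ (suc s) e (y ∷ τ) (there x∈) with ∈-insAt⁻ s e τ x∈
... | inj₁ x≡e = inj₁ x≡e
... | inj₂ x∈τ = inj₂ (there x∈τ)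

insertOne-isPerm : ∀ {n σ s} → IsPerm n σ → s ≤ n → IsPerm (suc n) (insertOne s σ)
insertOne-isPerm {n} {σ} {s} p s≤n = record
  { length≡ = trans (length-insAt s 1 (map suc σ) s≤len) (cong suc len)
  ; ⊆oneTo  = All.tabulate ⊆oneTo′
  ; oneTo⊆  = oneTo⊆′
  }
  where
  open IsPerm p
  len : length (map suc σ) ≡ n
  len = trans (length-map suc σ) length≡
  s≤len : s ≤ length (map suc σ)
  s≤len = subst (s ≤_) (sym len) s≤n
  ⊆oneTo′ : ∀ {x} → x ∈ insertOne s σ → x ∈ oneTo (suc n)
  ⊆oneTo′ x∈ with ∈-insAt⁻ s 1 (map suc σ) x∈
  ... | inj₁ refl = ∈-oneTo⁺ ≤-refl (s≤s z≤n)
  ... | inj₂ x∈sσ with ∈-map⁻ suc x∈sσ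
  ...   | a , a∈ , refl = ∈-oneTo⁺ (s≤s z≤n) (s≤s (proj₂ (∈-oneTo⁻ (All.lookup ⊆oneTo a∈))))
  oneTo⊆′ : ∀ {v} → v ∈ oneTo (suc n) → v ∈ insertOne s σ
  oneTo⊆′ {suc zero}    _  = ∈-insAt⁺ˡ s 1 (map suc σ)
  oneTo⊆′ {suc (suc v)} v∈ =
    ∈-insAt⁺ʳ s 1 (∈-map⁺ suc (oneTo⊆ (∈-oneTo⁺ (s≤s z≤n) (s≤s⁻¹ (proj₂ (∈-oneTo⁻ v∈))))))
  oneTo⊆′ {zero}        v∈ with () ← proj₁ (∈-oneTo⁻ v∈)

∈-++-∷⁺ : ∀ {v x : A} ys {zs} → v ∈ ys ++ zs → v ∈ ys ++ x ∷ zs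
∈-++-∷⁺ []       v∈          = there v∈
∈-++-∷⁺ (y ∷ ys) (here refl) = here refl
∈-++-∷⁺ (y ∷ ys) (there v∈)  = there (∈-++-∷⁺ ys v∈)

∈-++-∷⁻ : ∀ {v x : A} ys {zs} → v ∈ ys ++ x ∷ zs → v ≢ x → v ∈ ys ++ zs
∈-++-∷⁻ []       (here refl) v≢x = ⊥-elim (v≢x refl)
∈-++-∷⁻ []       (there v∈)  _   = v∈
∈-++-∷⁻ (y ∷ ys) (here refl) _   = here refl
∈-++-∷⁻ (y ∷ ys) (there v∈)  v≢x = there (∈-++-∷⁻ ys v∈ v≢x)

length-++-∷ : ∀ (ys : List A) {x zs} → length (ys ++ x ∷ zs) ≡ suc (length (ys ++ zs))
length-++-∷ []       = refl
length-++-∷ (y ∷ ys) = cong suc (length-++-∷ ys)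

interval⊆⇒≤length : ∀ m a xs → (∀ {v} → a < v → v ≤ a + m → v ∈ xs) → m ≤ length xs
interval⊆⇒≤length zero    a xs _ = z≤n
interval⊆⇒≤length (suc m) a xs ⊆xs with ys , zs , refl ← ∈-∃++ (⊆xs (m<m+n a (s≤s z≤n)) ≤-refl) =
  subst (suc m ≤_) (sym (length-++-∷ ys)) (s≤s (interval⊆⇒≤length m a (ys ++ zs) ⊆ys++zs))
  where
  ⊆ys++zs : ∀ {v} → a < v → v ≤ a + m → v ∈ ys ++ zs
  ⊆ys++zs a<v v≤ = ∈-++-∷⁻ ys (⊆xs a<v (≤-trans v≤ (+-monoʳ-≤ a (n≤1+n m))))
    (λ { refl → <-irrefl refl (≤-trans (s≤s v≤) (≤-reflexive (sym (+-suc a m)))) })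

-- α ++ β has n entries and already contains the n values 2, …, n+1.
one∉rest : ∀ {n} α β → IsPerm (suc n) (α ++ 1 ∷ β) → 1 ∈ α ++ β → ⊥
one∉rest {n} α β p 1∈ with γ , δ , α++β≡ ← ∈-∃++ 1∈ =
  <-irrefl refl (≤-trans (≤-reflexive (sym n≡)) (interval⊆⇒≤length n 1 (γ ++ δ) ⊆γ++δ))
  where
  open IsPerm p
  n≡ : n ≡ suc (length (γ ++ δ))
  n≡ = trans (suc-injective (trans (sym length≡) (length-++-∷ α)))
             (trans (cong length α++β≡) (length-++-∷ γ))
  ⊆γ++δ : ∀ {v} → 1 < v → v ≤ suc n → v ∈ γ ++ δ
  ⊆γ++δ 1<v v≤ = ∈-++-∷⁻ γ (subst (_ ∈_) α++β≡ (∈-++-∷⁻ α (oneTo⊆ (∈-oneTo⁺ (<⇒≤ 1<v) v≤)) 1≢)) 1≢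
    where
    1≢ : _ ≢ 1
    1≢ refl = <-irrefl refl 1<v

IsPerm-suc⇒insertOne : ∀ {n π} → IsPerm (suc n) π → ∃₂ λ s σ → s ≤ n × IsPerm n σ × π ≡ insertOne s σ
IsPerm-suc⇒insertOne {n} {π} p with α , β , refl ← ∈-∃++ (IsPerm.oneTo⊆ p (∈-oneTo⁺ ≤-refl (s≤s z≤n))) =
  length α , map pred (α ++ β) , s≤n , σ-perm , sym π≡
  where
  open IsPerm p
  τ = α ++ β
  τ-length : length τ ≡ n
  τ-length = suc-injective (trans (sym (length-++-∷ α)) length≡)
  τ-entry : ∀ {x} → x ∈ τ → ∃ λ y → x ≡ suc y × y ∈ oneTo n
  τ-entry {zero}        x∈ with () ← proj₁ (∈-oneTo⁻ (All.lookup ⊆oneTo (∈-++-∷⁺ α x∈)))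
  τ-entry {suc zero}    x∈ = ⊥-elim (one∉rest α β p x∈)
  τ-entry {suc (suc y)} x∈ =
    suc y , refl , ∈-oneTo⁺ (s≤s z≤n) (s≤s⁻¹ (proj₂ (∈-oneTo⁻ (All.lookup ⊆oneTo (∈-++-∷⁺ α x∈)))))
  s≤n : length α ≤ n
  s≤n = subst (length α ≤_) τ-length (subst (length α ≤_) (sym (length-++ α)) (m≤m+n (length α) (length β)))
  σ-perm : IsPerm n (map pred τ)
  σ-perm = record
    { length≡ = trans (length-map pred τ) τ-length
    ; ⊆oneTo  = All.tabulate λ y∈ → case-pred (∈-map⁻ pred y∈)
    ; oneTo⊆  = λ {v} v∈ → ∈-map⁺ pred (∈-++-∷⁻ α (oneTo⊆ (∈-oneTo⁺ (s≤s z≤n) (s≤s (proj₂ (∈-oneTo⁻ v∈)))))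
                                          (λ eq → <-irrefl (sym (suc-injective eq)) (proj₁ (∈-oneTo⁻ v∈))))
    }
    where
    case-pred : ∀ {y} → ∃ (λ x → x ∈ τ × y ≡ pred x) → y ∈ oneTo n
    case-pred (x , x∈ , refl) with τ-entry x∈
    ... | y , refl , y∈ = y∈
  π≡ : insertOne (length α) (map pred τ) ≡ α ++ 1 ∷ β
  π≡ = begin
    insAt (length α) 1 (map suc (map pred τ))  ≡⟨ cong (insAt (length α) 1) (sym (map-∘ τ)) ⟩
    insAt (length α) 1 (map (suc ∘ pred) τ)    ≡⟨ cong (insAt (length α) 1) (map-id-local (All.tabulate suc-pred≡)) ⟩
    insAt (length α) 1 τ                       ≡⟨ insAt-++ 1 α β ⟩
    α ++ 1 ∷ β                                 ∎
    where
    open ≡-Reasoning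
    suc-pred≡ : ∀ {x} → x ∈ τ → suc (pred x) ≡ x
    suc-pred≡ x∈ with τ-entry x∈
    ... | _ , refl , _ = refl

IsPerm⇒positive : ∀ {n σ} → IsPerm n σ → All (1 ≤_) σ
IsPerm⇒positive p = All.map (proj₁ ∘ ∈-oneTo⁻) (IsPerm.⊆oneTo p)

IsPerm-at : ∀ {n π y} → IsPerm n π → 1 ≤ y → y ≤ n → 1 ≤ at π y × at π y ≤ n
IsPerm-at {π = π} p 1≤y y≤n =
  ∈-oneTo⁻ (All.lookup (IsPerm.⊆oneTo p) (at-∈ π 1≤y (subst (_ ≤_) (sym (IsPerm.length≡ p)) y≤n)))

splitAtOne : List ℕ → ℕ × List ℕ
splitAtOne []              = 0 , []
splitAtOne (suc zero ∷ xs) = 0 , map pred xs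
splitAtOne (x ∷ xs)        = suc (proj₁ (splitAtOne xs)) , pred x ∷ proj₂ (splitAtOne xs)

splitAtOne-insertOne : ∀ s {σ} → All (1 ≤_) σ → s ≤ length σ → splitAtOne (insertOne s σ) ≡ (s , σ)
splitAtOne-insertOne zero    {σ} _ _ = cong (0 ,_) (trans (sym (map-∘ σ)) (map-id σ))
splitAtOne-insertOne (suc s) {suc a ∷ σ} (s≤s z≤n ∷ σ⁺) (s≤s s≤)
  rewrite splitAtOne-insertOne s σ⁺ s≤ = refl

insertOne-injective : ∀ {s t σ τ} → All (1 ≤_) σ → All (1 ≤_) τ → s ≤ length σ → t ≤ length τ →
                      insertOne s σ ≡ insertOne t τ → s ≡ t × σ ≡ τ
insertOne-injective {s} {t} {σ} {τ} σ⁺ τ⁺ s≤ t≤ eq with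
  trans (sym (splitAtOne-insertOne s σ⁺ s≤)) (trans (cong splitAtOne eq) (splitAtOne-insertOne t τ⁺ t≤))
... | refl = refl , refl

Unique-map⁺-local : ∀ (f : A → B) {xs} → (∀ {x y} → x ∈ xs → y ∈ xs → f x ≡ f y → x ≡ y) →
                    Unique xs → Unique (map f xs)
Unique-map⁺-local f         inj []           = []
Unique-map⁺-local f {x ∷ xs} inj (x∉ ∷ uxs) =
  All-map⁺ (All.tabulate λ {y} y∈ fx≡fy → All.lookup x∉ y∈ (inj (here refl) (there y∈) fx≡fy))
  ∷ Unique-map⁺-local f (λ x∈ y∈ → inj (there x∈) (there y∈)) uxs

Unique-concatMap⁺ : ∀ (f : A → List B) (key : B → A) {xs} → Unique xs →
                    (∀ {x} → x ∈ xs → Unique (f x)) →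
                    (∀ {x z} → x ∈ xs → z ∈ f x → key z ≡ x) → Unique (concatMap f xs)
Unique-concatMap⁺ f key         []           _   _     = []
Unique-concatMap⁺ f key {x ∷ xs} (x∉ ∷ uxs) ufx keyed =
  Unique.++⁺ (ufx (here refl)) (Unique-concatMap⁺ f key uxs (ufx ∘ there) (keyed ∘ there)) disjoint
  where
  disjoint : ∀ {z} → z ∈ f x × z ∈ concatMap f xs → ⊥
  disjoint (z∈fx , z∈rest) with y , y∈ , z∈fy ← find (∈-concatMap⁻ f {xs = xs} z∈rest) =
    All.lookup x∉ y∈ (trans (sym (keyed (here refl) z∈fx)) (keyed (there y∈) z∈fy))

-- The position of the y-th entry of σ in insertOne s σ (positions are 1-based, as for at).
punchIn : ℕ → ℕ → ℕ
punchIn s       zero    = zero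
punchIn zero    (suc y) = suc (suc y)
punchIn (suc s) (suc y) = suc (punchIn s y)

punchIn-≤ : ∀ {s y} → y ≤ s → punchIn s y ≡ y
punchIn-≤ {s}     {zero}  _        = refl
punchIn-≤ {suc s} {suc y} (s≤s y≤) = cong suc (punchIn-≤ y≤)

punchIn-> : ∀ {s y} → s < y → punchIn s y ≡ suc y
punchIn-> {zero}  {suc y} _        = refl
punchIn-> {suc s} {suc y} (s≤s s<) = cong suc (punchIn-> s<)

punchIn-<ᵇ : ∀ s y z → (punchIn s y <ᵇ punchIn s z) ≡ (y <ᵇ z)
punchIn-<ᵇ s       zero    zero    = refl
punchIn-<ᵇ zero    zero    (suc z) = refl
punchIn-<ᵇ (suc s) zero    (suc z) = refl
punchIn-<ᵇ zero    (suc y) zero    = refl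
punchIn-<ᵇ (suc s) (suc y) zero    = refl
punchIn-<ᵇ zero    (suc y) (suc z) = refl
punchIn-<ᵇ (suc s) (suc y) (suc z) = punchIn-<ᵇ s y z

punchIn-bounded : ∀ s {y n} → 1 ≤ y → y ≤ n → 1 ≤ punchIn s y × punchIn s y ≤ suc n
punchIn-bounded zero    {suc y} _ y≤n = s≤s z≤n , s≤s y≤n
punchIn-bounded (suc s) {suc zero}    _ (s≤s _)   = s≤s z≤n , s≤s z≤n
punchIn-bounded (suc s) {suc (suc y)} _ (s≤s y≤n) = s≤s z≤n , s≤s (proj₂ (punchIn-bounded s (s≤s z≤n) y≤n))

punchIn-surjective : ∀ {s n x} → s ≤ n → 1 ≤ x → x ≤ suc n → x ≢ suc s →
                     ∃ λ y → 1 ≤ y × y ≤ n × punchIn s y ≡ x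
punchIn-surjective {zero}  {n} {suc zero}    _ _ _ x≢ = ⊥-elim (x≢ refl)
punchIn-surjective {zero}  {n} {suc (suc x)} _ _ (s≤s x<) _ = suc x , s≤s z≤n , x< , refl
punchIn-surjective {suc s} {suc n} {suc zero} _ _ _ _ = 1 , s≤s z≤n , s≤s z≤n , refl
punchIn-surjective {suc s} {suc n} {suc (suc x)} (s≤s s≤) _ (s≤s x≤) x≢
  with y , _ , y≤ , eq ← punchIn-surjective s≤ (s≤s z≤n) x≤ (x≢ ∘ cong suc) =
  suc y , s≤s z≤n , s≤s y≤ , cong suc eq

at-insAt-punchIn : ∀ s e τ {y} → 1 ≤ y → s ≤ length τ → at (insAt s e τ) (punchIn s y) ≡ at τ y
at-insAt-punchIn zero          e τ       {suc y}       _ _        = refl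
at-insAt-punchIn (suc s)       e (a ∷ τ) {suc zero}    _ _        = refl
at-insAt-punchIn (suc zero)    e (a ∷ τ) {suc (suc y)} _ (s≤s s≤) = at-insAt-punchIn zero e τ (s≤s z≤n) s≤
at-insAt-punchIn (suc (suc s)) e (a ∷ τ) {suc (suc y)} _ (s≤s s≤) = at-insAt-punchIn (suc s) e τ (s≤s z≤n) s≤

at-insAt-slot : ∀ s e τ → s ≤ length τ → at (insAt s e τ) (suc s) ≡ e
at-insAt-slot zero    e τ       _        = refl
at-insAt-slot (suc s) e (a ∷ τ) (s≤s s≤) = at-insAt-slot s e τ s≤

module _ {s} (σ : List ℕ) (s≤ : s ≤ length σ) where

  private
    s≤′ : s ≤ length (map suc σ)
    s≤′ = subst (s ≤_) (sym (length-map suc σ)) s≤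

  length-insertOne : length (insertOne s σ) ≡ suc (length σ)
  length-insertOne = trans (length-insAt s 1 (map suc σ) s≤′) (cong suc (length-map suc σ))

  at-insertOne-slot : at (insertOne s σ) (suc s) ≡ 1
  at-insertOne-slot = at-insAt-slot s 1 (map suc σ) s≤′

  at-insertOne-punchIn : ∀ {y} → 1 ≤ y → y ≤ length σ → at (insertOne s σ) (punchIn s y) ≡ suc (at σ y)
  at-insertOne-punchIn 1≤y y≤ = trans (at-insAt-punchIn s 1 (map suc σ) 1≤y s≤′) (at-map suc σ 1≤y y≤)

anyL-oneTo-punchIn : ∀ {s n} (Q : ℕ → Bool) → s ≤ n →
                     anyL Q (oneTo (suc n)) ≡ anyL (Q ∘ punchIn s) (oneTo n) ∨ Q (suc s)
anyL-oneTo-punchIn {s} {n} Q s≤n = T⇔T⇒≡ ⇒ ⇐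
  where
  ⇒ : T (anyL Q (oneTo (suc n))) → T (anyL (Q ∘ punchIn s) (oneTo n) ∨ Q (suc s))
  ⇒ t with x , x∈ , Qx ← anyL⁻ Q (oneTo (suc n)) t with suc s ≟ x
  ... | yes refl = T-∨⁺ʳ Qx
  ... | no  x≢
    with y , 1≤y , y≤n , refl ← punchIn-surjective s≤n (proj₁ (∈-oneTo⁻ x∈)) (proj₂ (∈-oneTo⁻ x∈)) (x≢ ∘ sym) =
    T-∨⁺ˡ (anyL⁺ (Q ∘ punchIn s) (∈-oneTo⁺ 1≤y y≤n) Qx)
  ⇐ : T (anyL (Q ∘ punchIn s) (oneTo n) ∨ Q (suc s)) → T (anyL Q (oneTo (suc n)))
  ⇐ t with T-∨⁻ {anyL (Q ∘ punchIn s) (oneTo n)} t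
  ... | inj₂ Qs = anyL⁺ Q (∈-oneTo⁺ (s≤s z≤n) (s≤s s≤n)) Qs
  ... | inj₁ t′ with y , y∈ , Qy ← anyL⁻ (Q ∘ punchIn s) (oneTo n) t′ =
    anyL⁺ Q (uncurry ∈-oneTo⁺ (punchIn-bounded s (proj₁ (∈-oneTo⁻ y∈)) (proj₂ (∈-oneTo⁻ y∈)))) Qy

-- Mesh pattern occurrences

inRect : ℕ × ℕ → ℕ × ℕ → ℕ → ℕ → Bool
inRect (p , p′) (v , v′) x w = (p <ᵇ x) ∧ (x <ᵇ p′) ∧ (v <ᵇ w) ∧ (w <ᵇ v′)

inBox : List ℕ → ℕ → ℕ → Box → ℕ → Bool
inBox π i j (a , b) x = inRect (bnd (suc (length π)) i j a) (bnd (suc (length π)) (at π i) (at π j) b) x (at π x)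

isOccurrence : List Box → List ℕ → ℕ → ℕ → Bool
isOccurrence R π i j = (i <ᵇ j) ∧ (at π i <ᵇ at π j) ∧ allL (boxEmpty π i j) R

NoBottomRow : List Box → Set
NoBottomRow = All (λ box → proj₂ box ≢ Fin.zero)

inRect-punchIn : ∀ {s n} i j a V y w → s ≤ n →
  inRect (bnd (suc (suc n)) (punchIn s i) (punchIn s j) a) V (punchIn s y) w ≡ inRect (bnd (suc n) i j a) V y w
inRect-punchIn {s} i j Fin.zero V y w _ =
  cong₂ _∧_ (punchIn-<ᵇ s 0 y) (cong₂ _∧_ (punchIn-<ᵇ s y i) refl)
inRect-punchIn {s} i j (Fin.suc Fin.zero) V y w _ =
  cong₂ _∧_ (punchIn-<ᵇ s i y) (cong₂ _∧_ (punchIn-<ᵇ s y j) refl)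
inRect-punchIn {s} {n} i j (Fin.suc (Fin.suc Fin.zero)) V y w s≤n =
  cong₂ _∧_ (punchIn-<ᵇ s j y)
    (cong₂ _∧_ (trans (cong (punchIn s y <ᵇ_) (sym (punchIn-> (s≤s s≤n)))) (punchIn-<ᵇ s y (suc n))) refl)

inRect-suc : ∀ P M u w (b : Fin 2) x v →
  inRect P (bnd (suc M) (suc u) (suc w) (Fin.suc b)) x (suc v) ≡ inRect P (bnd M u w (Fin.suc b)) x v
inRect-suc P M u w Fin.zero            x v = refl
inRect-suc P M u w (Fin.suc Fin.zero) x v = refl

inRect-one : ∀ P u w x → inRect P (suc u , w) x 1 ≡ false
inRect-one (p , p′) u w x = trans (cong ((p <ᵇ x) ∧_) (∧-zeroʳ (x <ᵇ p′))) (∧-zeroʳ (p <ᵇ x))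

-- The new entry 1 lies below every other value, so it can only fall into boxes of the bottom row:
-- for patterns without such boxes, the occurrences avoiding it are exactly those of σ.
module MinimumInserted {σ π : List ℕ} {s} (s≤ : s ≤ length σ) (length-π : length π ≡ suc (length σ))
  (at-punchIn : ∀ {y} → 1 ≤ y → y ≤ length σ → at π (punchIn s y) ≡ suc (at σ y))
  (at-slot : at π (suc s) ≡ 1) where

  private
    n = length σ
    f = punchIn s

  inBox-punchIn : ∀ {i j y} a (b : Fin 2) → 1 ≤ i → i ≤ n → 1 ≤ j → j ≤ n → 1 ≤ y → y ≤ n →
                  inBox π (f i) (f j) (a , Fin.suc b) (f y) ≡ inBox σ i j (a , Fin.suc b) y
  inBox-punchIn {i} {j} {y} a b 1≤i i≤ 1≤j j≤ 1≤y y≤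
    rewrite length-π | at-punchIn 1≤i i≤ | at-punchIn 1≤j j≤ | at-punchIn 1≤y y≤ =
    trans (inRect-suc (bnd (suc (suc n)) (f i) (f j) a) (suc n) (at σ i) (at σ j) b (f y) (at σ y))
          (inRect-punchIn i j a (bnd (suc n) (at σ i) (at σ j) (Fin.suc b)) y (at σ y) s≤)

  inBox-slot : ∀ {i j} a (b : Fin 2) → 1 ≤ i → i ≤ n → 1 ≤ j → j ≤ n →
               inBox π (f i) (f j) (a , Fin.suc b) (suc s) ≡ false
  inBox-slot {i} {j} a Fin.zero 1≤i i≤ 1≤j j≤
    rewrite at-punchIn 1≤i i≤ | at-punchIn 1≤j j≤ | at-slot =
    inRect-one (bnd (suc (length π)) (f i) (f j) a) (at σ i) (suc (at σ j)) (suc s)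
  inBox-slot {i} {j} a (Fin.suc Fin.zero) 1≤i i≤ 1≤j j≤
    rewrite at-punchIn 1≤j j≤ | at-slot =
    inRect-one (bnd (suc (length π)) (f i) (f j) a) (at σ j) (suc (length π)) (suc s)

  boxEmpty-punchIn : ∀ {i j} box → proj₂ box ≢ Fin.zero → 1 ≤ i → i ≤ n → 1 ≤ j → j ≤ n →
                     boxEmpty π (f i) (f j) box ≡ boxEmpty σ i j box
  boxEmpty-punchIn (a , Fin.zero) b≢0 _ _ _ _ = ⊥-elim (b≢0 refl)
  boxEmpty-punchIn {i} {j} (a , Fin.suc b) _ 1≤i i≤ 1≤j j≤ = cong not (begin
    anyL (inBox π (f i) (f j) (a , Fin.suc b)) (oneTo (length π))
      ≡⟨ cong (λ m → anyL (inBox π (f i) (f j) (a , Fin.suc b)) (oneTo m)) length-π ⟩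
    anyL (inBox π (f i) (f j) (a , Fin.suc b)) (oneTo (suc n))
      ≡⟨ anyL-oneTo-punchIn (inBox π (f i) (f j) (a , Fin.suc b)) s≤ ⟩
    anyL (inBox π (f i) (f j) (a , Fin.suc b) ∘ f) (oneTo n) ∨ inBox π (f i) (f j) (a , Fin.suc b) (suc s)
      ≡⟨ cong₂ _∨_ (anyL-cong (oneTo n) λ y∈ → uncurry (inBox-punchIn a b 1≤i i≤ 1≤j j≤) (∈-oneTo⁻ y∈))
                   (inBox-slot a b 1≤i i≤ 1≤j j≤) ⟩
    anyL (inBox σ i j (a , Fin.suc b)) (oneTo n) ∨ false
      ≡⟨ ∨-identityʳ (anyL (inBox σ i j (a , Fin.suc b)) (oneTo n)) ⟩
    anyL (inBox σ i j (a , Fin.suc b)) (oneTo n) ∎)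
    where open ≡-Reasoning

  isOccurrence-punchIn : ∀ {R i j} → NoBottomRow R → 1 ≤ i → i ≤ n → 1 ≤ j → j ≤ n →
                         isOccurrence R π (f i) (f j) ≡ isOccurrence R σ i j
  isOccurrence-punchIn {R} {i} {j} R↑ 1≤i i≤ 1≤j j≤ =
    cong₂ _∧_ (punchIn-<ᵇ s i j)
      (cong₂ _∧_ (cong₂ _<ᵇ_ (at-punchIn 1≤i i≤) (at-punchIn 1≤j j≤))
        (allL-cong R λ {box} box∈ → boxEmpty-punchIn box (All.lookup R↑ box∈) 1≤i i≤ 1≤j j≤))

  isOccurrence-toSlot : ∀ {R i} → 1 ≤ i → i ≤ n → isOccurrence R π (f i) (suc s) ≡ false
  isOccurrence-toSlot {R} {i} 1≤i i≤
    rewrite at-punchIn 1≤i i≤ | at-slot = ∧-zeroʳ (f i <ᵇ suc s)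

  contains12-insertOne : ∀ {R} → NoBottomRow R →
    contains12 R π ≡ contains12 R σ ∨ anyL (isOccurrence R π (suc s)) (oneTo (suc n))
  contains12-insertOne {R} R↑ = begin
    anyL (λ i → anyL (isOccurrence R π i) (oneTo (length π))) (oneTo (length π))
      ≡⟨ cong (λ m → anyL (λ i → anyL (isOccurrence R π i) (oneTo m)) (oneTo m)) length-π ⟩
    anyL (λ i → anyL (isOccurrence R π i) (oneTo (suc n))) (oneTo (suc n))
      ≡⟨ anyL-oneTo-punchIn (λ i → anyL (isOccurrence R π i) (oneTo (suc n))) s≤ ⟩
    anyL (λ y → anyL (isOccurrence R π (f y)) (oneTo (suc n))) (oneTo n) ∨ fromSlot
      ≡⟨ cong (_∨ fromSlot) (anyL-cong (oneTo n) λ y∈ → uncurry row (∈-oneTo⁻ y∈)) ⟩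
    contains12 R σ ∨ fromSlot ∎
    where
    open ≡-Reasoning
    fromSlot = anyL (isOccurrence R π (suc s)) (oneTo (suc n))
    row : ∀ {y} → 1 ≤ y → y ≤ n → anyL (isOccurrence R π (f y)) (oneTo (suc n)) ≡ anyL (isOccurrence R σ y) (oneTo n)
    row {y} 1≤y y≤ = begin
      anyL (isOccurrence R π (f y)) (oneTo (suc n))
        ≡⟨ anyL-oneTo-punchIn (isOccurrence R π (f y)) s≤ ⟩
      anyL (isOccurrence R π (f y) ∘ f) (oneTo n) ∨ isOccurrence R π (f y) (suc s)
        ≡⟨ cong₂ _∨_ (anyL-cong (oneTo n) λ z∈ → uncurry (isOccurrence-punchIn R↑ 1≤y y≤) (∈-oneTo⁻ z∈))
                     (isOccurrence-toSlot {R} 1≤y y≤) ⟩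
      anyL (isOccurrence R σ y) (oneTo n) ∨ false
        ≡⟨ ∨-identityʳ (anyL (isOccurrence R σ y) (oneTo n)) ⟩
      anyL (isOccurrence R σ y) (oneTo n) ∎

inRect⁺ : ∀ {p p′ v v′ x w} → p < x → x < p′ → v < w → w < v′ → T (inRect (p , p′) (v , v′) x w)
inRect⁺ p<x x<p′ v<w w<v′ = T-∧⁺ (<⇒<ᵇ p<x) (T-∧⁺ (<⇒<ᵇ x<p′) (T-∧⁺ (<⇒<ᵇ v<w) (<⇒<ᵇ w<v′)))

inBox⁻ : ∀ π i j box {x} → T (inBox π i j box x) →
         let (p , p′) = bnd (suc (length π)) i j (proj₁ box)
             (v , v′) = bnd (suc (length π)) (at π i) (at π j) (proj₂ box)
         in p < x × x < p′ × v < at π x × at π x < v′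
inBox⁻ π i j (a , b) {x} t =
  let t₁ , t′ = T-∧⁻ {p <ᵇ x} t
      t₂ , t″ = T-∧⁻ {x <ᵇ p′} t′
      t₃ , t₄ = T-∧⁻ {v <ᵇ at π x} t″
  in <ᵇ⇒< p x t₁ , <ᵇ⇒< x p′ t₂ , <ᵇ⇒< v (at π x) t₃ , <ᵇ⇒< (at π x) v′ t₄
  where
  p  = proj₁ (bnd (suc (length π)) i j a)
  p′ = proj₂ (bnd (suc (length π)) i j a)
  v  = proj₁ (bnd (suc (length π)) (at π i) (at π j) b)
  v′ = proj₂ (bnd (suc (length π)) (at π i) (at π j) b)

boxEmpty⁻ : ∀ {π i j x} box → T (boxEmpty π i j box) → x ∈ oneTo (length π) → ¬ T (inBox π i j box x)
boxEmpty⁻ {π} {i} {j} box empty x∈ t = T-not⁻ empty (anyL⁺ (inBox π i j box) x∈ t)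

boxEmpty⁺ : ∀ {π i j} box → (∀ {x} → x ∈ oneTo (length π) → ¬ T (inBox π i j box x)) → T (boxEmpty π i j box)
boxEmpty⁺ {π} {i} {j} box none = T-not⁺ λ t →
  let x , x∈ , tx = anyL⁻ (inBox π i j box) (oneTo (length π)) t in none x∈ tx

-- Each value strictly between π_i and π_j occurs somewhere and would lie in a middle-row box.
box₀₁ box₁₁ box₁₂ box₂₁ : Box
box₀₁ = Fin.zero , Fin.suc Fin.zero
box₁₁ = Fin.suc Fin.zero , Fin.suc Fin.zero
box₁₂ = Fin.suc Fin.zero , Fin.suc (Fin.suc Fin.zero)
box₂₁ = Fin.suc (Fin.suc Fin.zero) , Fin.suc Fin.zero

adjacentValues : ∀ {N π i j} → IsPerm N π → 1 ≤ i → j ≤ N → i < j → at π i < at π j →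
  T (boxEmpty π i j box₀₁) → T (boxEmpty π i j box₁₁) → T (boxEmpty π i j box₂₁) → at π j ≡ suc (at π i)
adjacentValues {N} {π} {i} {j} p 1≤i j≤N i<j πi<πj empty₀ empty₁ empty₂ with suc (at π i) ≟ at π j
... | yes eq = sym eq
... | no  ≢πj = ⊥-elim (locate (∈⇒at π (oneTo⊆ (∈-oneTo⁺ (s≤s z≤n) (≤-trans (<⇒≤ v<πj) πj≤N)))))
  where
  open IsPerm p
  v<πj : suc (at π i) < at π j
  v<πj = ≤∧≢⇒< πi<πj ≢πj
  πj≤N : at π j ≤ N
  πj≤N = proj₂ (IsPerm-at p (≤-trans (s≤s z≤n) i<j) j≤N)
  locate : (∃ λ x → 1 ≤ x × x ≤ length π × at π x ≡ suc (at π i)) → ⊥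
  locate (x , 1≤x , x≤ , πx≡) = inBoxes (<-cmp x i) (<-cmp x j)
    where
    x∈ : x ∈ oneTo (length π)
    x∈ = ∈-oneTo⁺ 1≤x x≤
    πi<πx : at π i < at π x
    πi<πx = subst (at π i <_) (sym πx≡) ≤-refl
    πx<πj : at π x < at π j
    πx<πj = subst (_< at π j) (sym πx≡) v<πj
    inBoxes : Tri (x < i) (x ≡ i) (i < x) → Tri (x < j) (x ≡ j) (j < x) → ⊥
    inBoxes (tri< x<i _ _) _ =
      boxEmpty⁻ {π} {i} {j} box₀₁ empty₀ x∈ (inRect⁺ 1≤x x<i πi<πx πx<πj)
    inBoxes (tri≈ _ x≡i _) _ = <-irrefl (cong (at π) (sym x≡i)) πi<πx
    inBoxes (tri> _ _ i<x) (tri< x<j _ _) =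
      boxEmpty⁻ {π} {i} {j} box₁₁ empty₁ x∈ (inRect⁺ i<x x<j πi<πx πx<πj)
    inBoxes (tri> _ _ _)   (tri≈ _ x≡j _) = <-irrefl (cong (at π) x≡j) πx<πj
    inBoxes (tri> _ _ _)   (tri> _ _ j<x) =
      boxEmpty⁻ {π} {i} {j} box₂₁ empty₂ x∈ (inRect⁺ j<x (s≤s x≤) πi<πx πx<πj)

pR-noBottomRow : NoBottomRow pR
pR-noBottomRow = (λ ()) ∷ (λ ()) ∷ (λ ()) ∷ (λ ()) ∷ []

module _ {n σ s} (σ-perm : IsPerm n σ) (s≤n : s ≤ n) where

  private
    π = insertOne s σ
    s≤ : s ≤ length σ
    s≤ = subst (s ≤_) (sym (IsPerm.length≡ σ-perm)) s≤n
    π-perm : IsPerm (suc n) π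
    π-perm = insertOne-isPerm σ-perm s≤n
    π[1+s]≡1 : at π (suc s) ≡ 1
    π[1+s]≡1 = at-insertOne-slot σ s≤
    π[2+s]≡ : suc s ≤ n → at π (suc (suc s)) ≡ suc (at σ (suc s))
    π[2+s]≡ 1+s≤n = trans (cong (at π) (sym (punchIn-> ≤-refl)))
      (at-insertOne-punchIn σ s≤ (s≤s z≤n) (subst (suc s ≤_) (sym (IsPerm.length≡ σ-perm)) 1+s≤n))

  occurrenceFromSlot⇒one : ∀ {j} → j ∈ oneTo (suc n) → T (isOccurrence pR π (suc s) j) → at σ (suc s) ≡ 1
  occurrenceFromSlot⇒one {j} j∈ t = fromPosition (m≤n⇒m<n∨m≡n s+1<j)
    where
    s+1<j : suc s < j
    s+1<j = <ᵇ⇒< (suc s) j (proj₁ (T-∧⁻ {suc s <ᵇ j} t))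
    rest = proj₂ (T-∧⁻ {suc s <ᵇ j} t)
    πs<πj : at π (suc s) < at π j
    πs<πj = <ᵇ⇒< _ _ (proj₁ (T-∧⁻ {at π (suc s) <ᵇ at π j} rest))
    empty : ∀ {box} → box ∈ pR → T (boxEmpty π (suc s) j box)
    empty = allL⁻ (boxEmpty π (suc s) j) pR (proj₂ (T-∧⁻ {at π (suc s) <ᵇ at π j} rest))
    j≤ : j ≤ suc n
    j≤ = proj₂ (∈-oneTo⁻ j∈)
    1+s≤n : suc s ≤ n
    1+s≤n = s≤s⁻¹ (≤-trans s+1<j j≤)
    πj≡2 : at π j ≡ 2
    πj≡2 = trans (adjacentValues π-perm (s≤s z≤n) j≤ s+1<j πs<πj
                    (empty (here refl)) (empty (there (here refl))) (empty (there (there (there (here refl))))))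
                 (cong suc π[1+s]≡1)
    fromPosition : suc (suc s) < j ⊎ suc (suc s) ≡ j → at σ (suc s) ≡ 1
    fromPosition (inj₂ refl) = suc-injective (trans (sym (π[2+s]≡ 1+s≤n)) πj≡2)
    fromPosition (inj₁ 2+s<j) = ≤-antisym σ[1+s]≤1 1≤σ[1+s]
      where
      x∈ : suc (suc s) ∈ oneTo (length π)
      x∈ = ∈-oneTo⁺ (s≤s z≤n) (subst (suc (suc s) ≤_) (sym (IsPerm.length≡ π-perm)) (s≤s 1+s≤n))
      πx≤ : at π (suc (suc s)) ≤ length π
      πx≤ = subst (at π (suc (suc s)) ≤_) (sym (IsPerm.length≡ π-perm))
              (proj₂ (IsPerm-at π-perm (s≤s z≤n) (s≤s 1+s≤n)))
      σ[1+s]≤1 : at σ (suc s) ≤ 1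
      σ[1+s]≤1 = s≤s⁻¹ (≮⇒≥ λ 2<πx → boxEmpty⁻ {π} {suc s} {j} box₁₂ (empty (there (there (here refl)))) x∈
        (inRect⁺ ≤-refl 2+s<j (subst₂ _<_ (sym πj≡2) (sym (π[2+s]≡ 1+s≤n)) 2<πx) (s≤s πx≤)))
      1≤σ[1+s] : 1 ≤ at σ (suc s)
      1≤σ[1+s] = proj₁ (IsPerm-at σ-perm (s≤s z≤n) 1+s≤n)

  one⇒occurrenceFromSlot : at σ (suc s) ≡ 1 → T (anyL (isOccurrence pR π (suc s)) (oneTo (suc n)))
  one⇒occurrenceFromSlot σ[1+s]≡1 =
    anyL⁺ (isOccurrence pR π (suc s)) (∈-oneTo⁺ (s≤s z≤n) (s≤s 1+s≤n))
      (T-∧⁺ (<⇒<ᵇ (n<1+n (suc s))) (T-∧⁺ (<⇒<ᵇ (subst₂ _<_ (sym π[1+s]≡1) (sym πx≡2) (n<1+n 1)))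
        (allL⁺ (boxEmpty π (suc s) (suc (suc s))) pR λ
          { (here refl)                         → noValueBetween Fin.zero
          ; (there (here refl))                 → noValueBetween (Fin.suc Fin.zero)
          ; (there (there (here refl)))         → noPositionBetween
          ; (there (there (there (here refl)))) → noValueBetween (Fin.suc (Fin.suc Fin.zero))
          })))
    where
    1+s≤n : suc s ≤ n
    1+s≤n with suc s ≤? n
    ... | yes 1+s≤n = 1+s≤n
    ... | no  1+s≰n =
      case trans (sym σ[1+s]≡1) (at-beyond σ (subst (_< suc s) (sym (IsPerm.length≡ σ-perm)) (≰⇒> 1+s≰n))) of λ ()
    πx≡2 : at π (suc (suc s)) ≡ 2
    πx≡2 = trans (π[2+s]≡ 1+s≤n) (cong suc σ[1+s]≡1)
    noValueBetween : ∀ a → T (boxEmpty π (suc s) (suc (suc s)) (a , Fin.suc Fin.zero))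
    noValueBetween a = boxEmpty⁺ {π} {suc s} {suc (suc s)} (a , Fin.suc Fin.zero) λ {x} _ t →
      let _ , _ , 1<w , w<2 = inBox⁻ π (suc s) (suc (suc s)) (a , Fin.suc Fin.zero) {x} t in
      <⇒≱ (subst (at π x <_) πx≡2 w<2) (subst (_< at π x) π[1+s]≡1 1<w)
    noPositionBetween : T (boxEmpty π (suc s) (suc (suc s)) box₁₂)
    noPositionBetween = boxEmpty⁺ {π} {suc s} {suc (suc s)} box₁₂ λ {x} _ t →
      let 1+s<x , x<2+s , _ = inBox⁻ π (suc s) (suc (suc s)) box₁₂ {x} t in <⇒≱ x<2+s 1+s<x

  contains12-pR-insertOne : contains12 pR π ≡ contains12 pR σ ∨ (at σ (suc s) ≡ᵇ 1)
  contains12-pR-insertOne =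
    trans (MinimumInserted.contains12-insertOne {σ} {π} {s} s≤ (length-insertOne σ s≤) (at-insertOne-punchIn σ s≤)
                                                 (at-insertOne-slot σ s≤) pR-noBottomRow)
          (cong (contains12 pR σ ∨_) (T⇔T⇒≡ occurrence⇒one one⇒occurrence))
    where
    fromSlot : ℕ → Bool
    fromSlot m = anyL (isOccurrence pR π (suc s)) (oneTo (suc m))
    occurrence⇒one : T (fromSlot (length σ)) → T (at σ (suc s) ≡ᵇ 1)
    occurrence⇒one t
      with j , j∈ , tj ← anyL⁻ (isOccurrence pR π (suc s)) (oneTo (suc n)) (subst (T ∘ fromSlot) (IsPerm.length≡ σ-perm) t) =
      ≡⇒≡ᵇ (at σ (suc s)) 1 (occurrenceFromSlot⇒one j∈ tj)
    one⇒occurrence : T (at σ (suc s) ≡ᵇ 1) → T (fromSlot (length σ))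
    one⇒occurrence t =
      subst (T ∘ fromSlot) (sym (IsPerm.length≡ σ-perm)) (one⇒occurrenceFromSlot (≡ᵇ⇒≡ (at σ (suc s)) 1 t))

-- Descents

descentAt : List ℕ → ℕ → Bool
descentAt π i = at π (suc i) <ᵇ at π i

countL-applyUpTo : ∀ {p q : ℕ → Bool} {f g : ℕ → ℕ} L → (∀ i → p (f i) ≡ q (g i)) →
                   countL p (applyUpTo f L) ≡ countL q (applyUpTo g L)
countL-applyUpTo zero    _  = refl
countL-applyUpTo {p} {q} {f} {g} (suc L) pf≡qg rewrite pf≡qg 0 =
  cong (λ c → if q (g 0) then suc c else c) (countL-applyUpTo L (pf≡qg ∘ suc))

des-∷-∷ : ∀ a b r → des (a ∷ b ∷ r) ≡ (if b <ᵇ a then 1 else 0) + des (b ∷ r)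
des-∷-∷ a b r with b <ᵇ a
... | true  = cong suc (countL-applyUpTo {descentAt (a ∷ b ∷ r)} {descentAt (b ∷ r)} (length r) λ _ → refl)
... | false = countL-applyUpTo {descentAt (a ∷ b ∷ r)} {descentAt (b ∷ r)} (length r) λ _ → refl

des-map-suc : ∀ σ → des (map suc σ) ≡ des σ
des-map-suc []          = refl
des-map-suc (a ∷ [])    = refl
des-map-suc (a ∷ b ∷ σ) = begin
  des (suc a ∷ suc b ∷ map suc σ)     ≡⟨ des-∷-∷ (suc a) (suc b) (map suc σ) ⟩
  [b<a] + des (map suc (b ∷ σ))       ≡⟨ cong (_+_ [b<a]) (des-map-suc (b ∷ σ)) ⟩
  [b<a] + des (b ∷ σ)                 ≡⟨ des-∷-∷ a b σ ⟨
  des (a ∷ b ∷ σ)                     ∎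
  where
  open ≡-Reasoning
  [b<a] = if b <ᵇ a then 1 else 0

-- The new 1 forms a descent with its left neighbour and splits the pair it is inserted into.
raisesDes : List ℕ → ℕ → Bool
raisesDes σ zero    = false
raisesDes σ (suc s) = (suc s ≡ᵇ length σ) ∨ not (descentAt σ (suc s))

des-insertOne : ∀ s σ → All (1 ≤_) σ → s ≤ length σ →
                des (insertOne s σ) ≡ (if raisesDes σ s then suc (des σ) else des σ)
des-insertOne zero [] _ _ = refl
des-insertOne zero (a ∷ σ) _ _ = trans (des-∷-∷ 1 (suc a) (map suc σ)) (des-map-suc (a ∷ σ))
des-insertOne (suc zero) (suc a ∷ []) (s≤s z≤n ∷ []) _ = refl
des-insertOne (suc zero) (suc a ∷ b ∷ σ) (s≤s z≤n ∷ σ⁺) _ = begin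
  des (suc (suc a) ∷ 1 ∷ suc b ∷ map suc σ)
    ≡⟨ des-∷-∷ (suc (suc a)) 1 (suc b ∷ map suc σ) ⟩
  suc (des (1 ∷ suc b ∷ map suc σ))
    ≡⟨ cong suc (des-insertOne zero (b ∷ σ) σ⁺ z≤n) ⟩
  suc (des (b ∷ σ))
    ≡⟨ newDescent (b <ᵇ suc a) ⟩
  (if not (b <ᵇ suc a) then suc ([b<a] + des (b ∷ σ)) else [b<a] + des (b ∷ σ))
    ≡⟨ cong (λ d → if not (b <ᵇ suc a) then suc d else d) (des-∷-∷ (suc a) b σ) ⟨
  (if not (b <ᵇ suc a) then suc (des (suc a ∷ b ∷ σ)) else des (suc a ∷ b ∷ σ)) ∎
  where
  open ≡-Reasoning
  [b<a] = if b <ᵇ suc a then 1 else 0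
  newDescent : ∀ c → suc (des (b ∷ σ)) ≡
    (if not c then suc ((if c then 1 else 0) + des (b ∷ σ)) else (if c then 1 else 0) + des (b ∷ σ))
  newDescent true  = refl
  newDescent false = refl
des-insertOne (suc (suc s)) (a ∷ b ∷ σ) (_ ∷ σ⁺) (s≤s s≤) = begin
  des (suc a ∷ insertOne (suc s) (b ∷ σ))
    ≡⟨ des-∷-∷ (suc a) (suc b) (insAt s 1 (map suc σ)) ⟩
  [b<a] + des (insertOne (suc s) (b ∷ σ))
    ≡⟨ cong (_+_ [b<a]) (des-insertOne (suc s) (b ∷ σ) σ⁺ s≤) ⟩
  [b<a] + (if r then suc (des (b ∷ σ)) else des (b ∷ σ))
    ≡⟨ +-if r ⟩
  (if r then suc ([b<a] + des (b ∷ σ)) else [b<a] + des (b ∷ σ))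
    ≡⟨ cong (λ d → if r then suc d else d) (des-∷-∷ a b σ) ⟨
  (if r then suc (des (a ∷ b ∷ σ)) else des (a ∷ b ∷ σ)) ∎
  where
  open ≡-Reasoning
  [b<a] = if b <ᵇ a then 1 else 0
  r = raisesDes (b ∷ σ) (suc s)
  +-if : ∀ r → [b<a] + (if r then suc (des (b ∷ σ)) else des (b ∷ σ)) ≡
               (if r then suc ([b<a] + des (b ∷ σ)) else [b<a] + des (b ∷ σ))
  +-if true  = +-suc [b<a] (des (b ∷ σ))
  +-if false = refl

des≤ : ∀ π → des π ≤ length π ∸ 1
des≤ π = subst (des π ≤_) (length-applyUpTo suc (length π ∸ 1))
                (countL-≤-length (descentAt π) (oneTo (length π ∸ 1)))

IsPerm⇒des≤ : ∀ {n π} → IsPerm n π → des π ≤ n ∸ 1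
IsPerm⇒des≤ {π = π} p = subst (λ m → des π ≤ m ∸ 1) (IsPerm.length≡ p) (des≤ π)

countL-raisesDes : ∀ {n σ} → length σ ≡ suc n → countL (raisesDes σ) (upTo (suc (suc n))) ≡ suc n ∸ des σ
countL-raisesDes {n} {σ} len = begin
  countL (raisesDes σ) (0 ∷ oneTo (suc n))
    ≡⟨ cong (countL (raisesDes σ)) (applyUpTo-∷ʳ suc n) ⟨
  countL (raisesDes σ) (oneTo n ++ suc n ∷ [])
    ≡⟨ countL-++ (raisesDes σ) (oneTo n) (suc n ∷ []) ⟩
  countL (raisesDes σ) (oneTo n) + countL (raisesDes σ) (suc n ∷ [])
    ≡⟨ cong₂ _+_ (countL-cong (oneTo n) λ s∈ → inner (∈-oneTo⁻ s∈)) last ⟩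
  countL (not ∘ descentAt σ) (oneTo n) + 1
    ≡⟨ cong (_+ 1) ascents ⟩
  (n ∸ des σ) + 1
    ≡⟨ +-comm (n ∸ des σ) 1 ⟩
  suc (n ∸ des σ)
    ≡⟨ +-∸-assoc 1 des≤n ⟨
  suc n ∸ des σ ∎
  where
  open ≡-Reasoning
  des≡ : des σ ≡ countL (descentAt σ) (oneTo n)
  des≡ = cong (λ m → countL (descentAt σ) (oneTo (m ∸ 1))) len
  des≤n : des σ ≤ n
  des≤n = subst (λ m → des σ ≤ m ∸ 1) len (des≤ σ)
  inner : ∀ {s} → 1 ≤ s × s ≤ n → raisesDes σ s ≡ not (descentAt σ s)
  inner {suc s} (_ , s<n) rewrite len = cong (_∨ not (descentAt σ (suc s)))
    (¬T⇒≡false λ t → <-irrefl (≡ᵇ⇒≡ s n t) s<n)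
  last : countL (raisesDes σ) (suc n ∷ []) ≡ 1
  last rewrite len | T⇒≡true (≡⇒≡ᵇ n n refl) = refl
  ascents : countL (not ∘ descentAt σ) (oneTo n) ≡ n ∸ des σ
  ascents = begin
    countL (not ∘ descentAt σ) (oneTo n)
      ≡⟨ m+n∸n≡m _ (des σ) ⟨
    countL (not ∘ descentAt σ) (oneTo n) + des σ ∸ des σ
      ≡⟨ cong (λ d → countL (not ∘ descentAt σ) (oneTo n) + d ∸ des σ) des≡ ⟩
    countL (not ∘ descentAt σ) (oneTo n) + countL (descentAt σ) (oneTo n) ∸ des σ
      ≡⟨ cong (_∸ des σ) (trans (countL-not (descentAt σ) (oneTo n)) (length-applyUpTo suc n)) ⟩
    n ∸ des σ ∎

raisesDes-insertOne-slot : ∀ {s σ} → All (1 ≤_) σ → s ≤ length σ → raisesDes (insertOne s σ) s ≡ false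
raisesDes-insertOne-slot {zero}  _  _  = refl
raisesDes-insertOne-slot {suc s} {σ} σ⁺ s<len = cong₂ (λ a b → a ∨ not b) lastSlot? descent
  where
  π = insertOne (suc s) σ
  lastSlot? : (suc s ≡ᵇ length π) ≡ false
  lastSlot? = ¬T⇒≡false λ t → <-irrefl (suc-injective (trans (≡ᵇ⇒≡ _ _ t) (length-insertOne σ s<len))) s<len
  descent : (at π (suc (suc s)) <ᵇ at π (suc s)) ≡ true
  descent = T⇒≡true (<⇒<ᵇ (subst₂ _<_ (sym (at-insertOne-slot σ s<len))
    (sym (trans (cong (at π) (sym (punchIn-≤ ≤-refl))) (at-insertOne-punchIn σ s<len (s≤s z≤n) s<len)))
    (s≤s (All.lookup σ⁺ (at-∈ σ (s≤s z≤n) s<len)))))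

slotBeforeOne : ∀ {n σ} → IsPerm (suc n) σ →
  ∃ λ p → p ≤ n × (∀ {s} → s ≤ suc n → (at σ (suc s) ≡ᵇ 1) ≡ (s ≡ᵇ p)) × raisesDes σ p ≡ false
slotBeforeOne {n} p with s , σ′ , s≤n , σ′-perm , refl ← IsPerm-suc⇒insertOne p =
  s , s≤n , (λ t≤ → T⇔T⇒≡ (oneAt⇒slot t≤) slot⇒oneAt) , raisesDes-insertOne-slot (IsPerm⇒positive σ′-perm) s≤
  where
  π = insertOne s σ′
  s≤ : s ≤ length σ′
  s≤ = subst (s ≤_) (sym (IsPerm.length≡ σ′-perm)) s≤n
  slot⇒oneAt : ∀ {t} → T (t ≡ᵇ s) → T (at π (suc t) ≡ᵇ 1)
  slot⇒oneAt {t} t≡s rewrite ≡ᵇ⇒≡ t s t≡s = ≡⇒≡ᵇ _ 1 (at-insertOne-slot σ′ s≤)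
  oneAt⇒slot : ∀ {t} → t ≤ suc n → T (at π (suc t) ≡ᵇ 1) → T (t ≡ᵇ s)
  oneAt⇒slot {t} t≤ πt≡1 with t ≟ s
  ... | yes t≡s = ≡⇒≡ᵇ t s t≡s
  ... | no  t≢s with m≤n⇒m<n∨m≡n t≤
  ...   | inj₂ refl = case trans (sym (≡ᵇ⇒≡ _ 1 πt≡1)) (at-beyond π π-length<) of λ ()
    where
    π-length< : length π < suc (suc n)
    π-length< = ≤-reflexive (cong suc (IsPerm.length≡ (insertOne-isPerm σ′-perm s≤n)))
  ...   | inj₁ t<1+n with y , 1≤y , y≤n , eq ← punchIn-surjective s≤n (s≤s z≤n) t<1+n (t≢s ∘ suc-injective) =
    ⊥-elim (<-irrefl (sym (suc-injective σ′y+1≡1)) (proj₁ (IsPerm-at σ′-perm 1≤y y≤n)))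
    where
    σ′y+1≡1 : suc (at σ′ y) ≡ 1
    σ′y+1≡1 = trans (sym (at-insertOne-punchIn σ′ s≤ 1≤y (subst (y ≤_) (sym (IsPerm.length≡ σ′-perm)) y≤n)))
                    (trans (cong (at π) eq) (≡ᵇ⇒≡ _ 1 πt≡1))

-- Putting 1 directly before the 1 of σ would create the occurrence (1, 2) of p.
validSlots : ℕ → List ℕ → List ℕ
validSlots n σ = filter (λ s → T? (not (at σ (suc s) ≡ᵇ 1))) (upTo (suc n))

extensions : ℕ → List ℕ → List (List ℕ)
extensions n σ = map (λ s → insertOne s σ) (validSlots n σ)

∈validSlots⁻ : ∀ {n σ s} → s ∈ validSlots n σ → s ≤ n × T (not (at σ (suc s) ≡ᵇ 1))
∈validSlots⁻ {n} {σ} s∈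
  with s∈slots , valid ← ∈-filter⁻ (λ s → T? (not (at σ (suc s) ≡ᵇ 1))) {xs = upTo (suc n)} s∈ =
  s≤s⁻¹ (∈-upTo⁻ s∈slots) , valid

countL-≡ᵇ-unique : ∀ {x} xs → Unique xs → x ∈ xs → countL (_≡ᵇ x) xs ≡ 1
countL-≡ᵇ-unique {x} (y ∷ xs) (y∉ ∷ uxs) x∈ with y ≟ x
... | yes refl rewrite T⇒≡true (≡⇒≡ᵇ y y refl) =
  cong suc (countL-≡0 (_≡ᵇ y) xs λ z∈ → ¬T⇒≡false λ t → All.lookup y∉ z∈ (sym (≡ᵇ⇒≡ _ y t)))
... | no  y≢x rewrite ¬T⇒≡false (y≢x ∘ ≡ᵇ⇒≡ y x) with x∈
...   | here x≡y = ⊥-elim (y≢x (sym x≡y))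
...   | there x∈xs = countL-≡ᵇ-unique xs uxs x∈xs

module _ {n σ} (σ-perm : IsPerm (suc n) σ) where

  private
    slots = upTo (suc (suc n))
    valid = validSlots (suc n) σ
    isOne : ℕ → Bool
    isOne s = at σ (suc s) ≡ᵇ 1
    p₀ = proj₁ (slotBeforeOne σ-perm)
    p₀≤n = proj₁ (proj₂ (slotBeforeOne σ-perm))
    isOne≡ : ∀ {s} → s ∈ slots → isOne s ≡ (s ≡ᵇ p₀)
    isOne≡ s∈ = proj₁ (proj₂ (proj₂ (slotBeforeOne σ-perm))) (s≤s⁻¹ (∈-upTo⁻ s∈))
    p₀-notRaised : raisesDes σ p₀ ≡ false
    p₀-notRaised = proj₂ (proj₂ (proj₂ (slotBeforeOne σ-perm)))

  length-validSlots : length (validSlots (suc n) σ) ≡ suc n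
  length-validSlots = suc-injective (begin
    suc (length valid)                            ≡⟨ +-comm 1 _ ⟩
    length valid + 1                              ≡⟨ cong₂ _+_ (countL-true valid) oneSlotBeforeOne ⟨
    countL (λ _ → true) valid + countL isOne slots ≡⟨ countL-filter isOne (λ _ → true) slots ⟩
    countL (λ _ → true) slots                     ≡⟨ countL-true slots ⟩
    length slots                                  ≡⟨ length-applyUpTo (λ i → i) (suc (suc n)) ⟩
    suc (suc n)                                   ∎)
    where
    open ≡-Reasoning
    oneSlotBeforeOne : countL isOne slots ≡ 1
    oneSlotBeforeOne = trans (countL-cong slots isOne≡)
      (countL-≡ᵇ-unique slots (Unique.upTo⁺ (suc (suc n))) (∈-upTo⁺ (s≤s (m≤n⇒m≤1+n p₀≤n))))

  countL-raisesDes-validSlots : countL (raisesDes σ) (validSlots (suc n) σ) ≡ suc n ∸ des σ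
  countL-raisesDes-validSlots = begin
    countL (raisesDes σ) (validSlots (suc n) σ)
      ≡⟨ +-identityʳ _ ⟨
    countL (raisesDes σ) (validSlots (suc n) σ) + 0
      ≡⟨ cong (_+_ (countL (raisesDes σ) (validSlots (suc n) σ))) raisedBeforeOne ⟨
    countL (raisesDes σ) (validSlots (suc n) σ) + countL (λ s → raisesDes σ s ∧ isOne s) slots
      ≡⟨ countL-filter isOne (raisesDes σ) slots ⟩
    countL (raisesDes σ) slots
      ≡⟨ countL-raisesDes (IsPerm.length≡ σ-perm) ⟩
    suc n ∸ des σ ∎
    where
    open ≡-Reasoning
    raisedBeforeOne : countL (λ s → raisesDes σ s ∧ isOne s) slots ≡ 0
    raisedBeforeOne = countL-≡0 _ slots λ {s} s∈ → trans (cong (raisesDes σ s ∧_) (isOne≡ s∈)) (atP₀ s)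
      where
      atP₀ : ∀ s → raisesDes σ s ∧ (s ≡ᵇ p₀) ≡ false
      atP₀ s with s ≟ p₀
      ... | yes refl = cong (_∧ (s ≡ᵇ s)) p₀-notRaised
      ... | no  s≢p₀ = trans (cong (raisesDes σ s ∧_) (¬T⇒≡false (s≢p₀ ∘ ≡ᵇ⇒≡ s p₀))) (∧-zeroʳ (raisesDes σ s))

  countL-¬raisesDes-validSlots : countL (not ∘ raisesDes σ) (validSlots (suc n) σ) ≡ des σ
  countL-¬raisesDes-validSlots = begin
    countL (not ∘ raisesDes σ) valid
      ≡⟨ m+n∸n≡m _ (countL (raisesDes σ) valid) ⟨
    countL (not ∘ raisesDes σ) valid + countL (raisesDes σ) valid ∸ countL (raisesDes σ) valid
      ≡⟨ cong₂ _∸_ (trans (countL-not (raisesDes σ) valid) length-validSlots) countL-raisesDes-validSlots ⟩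
    suc n ∸ (suc n ∸ des σ)
      ≡⟨ m∸[m∸n]≡n (m≤n⇒m≤1+n (IsPerm⇒des≤ σ-perm)) ⟩
    des σ ∎
    where open ≡-Reasoning

  countL-des-extensions : ∀ k → countL (λ π → des π ≡ᵇ k) (extensions (suc n) σ) ≡
    (if des σ ≡ᵇ k then des σ else 0) + (if suc (des σ) ≡ᵇ k then suc n ∸ des σ else 0)
  countL-des-extensions k = begin
    countL (λ π → des π ≡ᵇ k) (extensions (suc n) σ)
      ≡⟨ countL-map (λ π → des π ≡ᵇ k) (λ s → insertOne s σ) valid ⟩
    countL (λ s → des (insertOne s σ) ≡ᵇ k) valid
      ≡⟨ countL-cong valid (λ {s} s∈ → trans (cong (_≡ᵇ k) (des-insertOne s σ (IsPerm⇒positive σ-perm) (slot≤ s∈)))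
                                             (if-float (_≡ᵇ k) (raisesDes σ s))) ⟩
    countL (λ s → if raisesDes σ s then suc (des σ) ≡ᵇ k else des σ ≡ᵇ k) valid
      ≡⟨ countL-if (raisesDes σ) (suc (des σ) ≡ᵇ k) (des σ ≡ᵇ k) valid ⟩
    (if des σ ≡ᵇ k then countL (not ∘ raisesDes σ) valid else 0) +
    (if suc (des σ) ≡ᵇ k then countL (raisesDes σ) valid else 0)
      ≡⟨ cong₂ (λ a b → (if des σ ≡ᵇ k then a else 0) + (if suc (des σ) ≡ᵇ k then b else 0))
               countL-¬raisesDes-validSlots countL-raisesDes-validSlots ⟩
    (if des σ ≡ᵇ k then des σ else 0) + (if suc (des σ) ≡ᵇ k then suc n ∸ des σ else 0) ∎
    where
    open ≡-Reasoning
    slot≤ : ∀ {s} → s ∈ valid → s ≤ length σ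
    slot≤ s∈ = subst (_ ≤_) (sym (IsPerm.length≡ σ-perm)) (proj₁ (∈validSlots⁻ {suc n} {σ} s∈))

∨-≡false : ∀ {a b} → a ∨ b ≡ false → a ≡ false × b ≡ false
∨-≡false {false} b≡false = refl , b≡false

∈-concatMap⁺′ : ∀ (f : A → List B) {x xs z} → x ∈ xs → z ∈ f x → z ∈ concatMap f xs
∈-concatMap⁺′ f {xs = xs} x∈ z∈ = ∈-concatMap⁺ f {xs = xs} (Any.map (λ { refl → z∈ }) x∈)

module _ {n : ℕ} where

  extensions⊆Av : ∀ {π} → π ∈ concatMap (extensions n) (Av pR n) → π ∈ Av pR (suc n)
  extensions⊆Av π∈ with σ , σ∈ , π∈ext ← find (∈-concatMap⁻ (extensions n) {xs = Av pR n} π∈)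
    with s , s∈ , refl ← ∈-map⁻ (λ s → insertOne s σ) π∈ext
    with σ-perm , σ-avoids ← ∈Av⁻ pR n σ∈ | s≤n , valid ← ∈validSlots⁻ {n} {σ} s∈ =
    ∈Av⁺ pR (suc n) (insertOne-isPerm σ-perm s≤n)
      (trans (contains12-pR-insertOne σ-perm s≤n) (cong₂ _∨_ σ-avoids (Equivalence.to T-not-≡ valid)))

  Av⊆extensions : ∀ {π} → π ∈ Av pR (suc n) → π ∈ concatMap (extensions n) (Av pR n)
  Av⊆extensions π∈ with π-perm , π-avoids ← ∈Av⁻ pR (suc n) π∈
    with s , σ , s≤n , σ-perm , refl ← IsPerm-suc⇒insertOne π-perm
    with σ-avoids , notOne ← ∨-≡false (trans (sym (contains12-pR-insertOne σ-perm s≤n)) π-avoids) =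
    ∈-concatMap⁺′ (extensions n) (∈Av⁺ pR n σ-perm σ-avoids)
      (∈-map⁺ (λ s → insertOne s σ) (∈-filter⁺ (λ s → T? (not (at σ (suc s) ≡ᵇ 1)))
        (∈-upTo⁺ (s≤s s≤n)) (Equivalence.from T-not-≡ notOne)))

  extensions-unique : Unique (concatMap (extensions n) (Av pR n))
  extensions-unique = Unique-concatMap⁺ (extensions n) (proj₂ ∘ splitAtOne) (Av-unique pR n)
    (λ {σ} σ∈ → Unique-map⁺-local (λ s → insertOne s σ)
       (λ s∈ t∈ eq → proj₁ (insertOne-injective (positive σ∈) (positive σ∈) (slot≤ σ∈ s∈) (slot≤ σ∈ t∈) eq))
       (Unique.filter⁺ (λ s → T? (not (at σ (suc s) ≡ᵇ 1))) (Unique.upTo⁺ (suc n))))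
    (λ {σ} σ∈ z∈ → case ∈-map⁻ (λ s → insertOne s σ) z∈ of λ
       { (s , s∈ , refl) → cong proj₂ (splitAtOne-insertOne s (positive σ∈) (slot≤ σ∈ s∈)) })
    where
    positive : ∀ {σ} → σ ∈ Av pR n → All (1 ≤_) σ
    positive σ∈ = IsPerm⇒positive (proj₁ (∈Av⁻ pR n σ∈))
    slot≤ : ∀ {σ s} → σ ∈ Av pR n → s ∈ validSlots n σ → s ≤ length σ
    slot≤ {σ} σ∈ s∈ = subst (_ ≤_) (sym (IsPerm.length≡ (proj₁ (∈Av⁻ pR n σ∈)))) (proj₁ (∈validSlots⁻ {n} {σ} s∈))

  Av-suc↭extensions : Av pR (suc n) ↭ concatMap (extensions n) (Av pR n)
  Av-suc↭extensions = unique∧sameElements⇒↭ (Av-unique pR (suc n)) extensions-unique Av⊆extensions extensions⊆Av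

-- The recurrences

sum-map-cong : ∀ {f g : A → ℕ} xs → (∀ {x} → x ∈ xs → f x ≡ g x) → sum (map f xs) ≡ sum (map g xs)
sum-map-cong []       _   = refl
sum-map-cong (x ∷ xs) f≡g = cong₂ _+_ (f≡g (here refl)) (sum-map-cong xs (f≡g ∘ there))

sum-map-+ : ∀ (f g : A → ℕ) xs → sum (map (λ x → f x + g x) xs) ≡ sum (map f xs) + sum (map g xs)
sum-map-+ f g []       = refl
sum-map-+ f g (x ∷ xs) rewrite sum-map-+ f g xs = +-interchange (f x) (g x) (sum (map f xs)) (sum (map g xs))
  where
  +-interchange : ∀ a b c d → a + b + (c + d) ≡ a + c + (b + d)
  +-interchange = solve-∀

sum-map-const : ∀ c (xs : List A) → sum (map (λ _ → c) xs) ≡ c * length xs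
sum-map-const c []       = sym (*-zeroʳ c)
sum-map-const c (x ∷ xs) = trans (cong (_+_ c) (sum-map-const c xs)) (sym (*-suc c (length xs)))

sum-map-if : ∀ (h : A → ℕ) (g : ℕ → ℕ) k xs →
  sum (map (λ x → if h x ≡ᵇ k then g (h x) else 0) xs) ≡ g k * countL (λ x → h x ≡ᵇ k) xs
sum-map-if h g k []       = sym (*-zeroʳ (g k))
sum-map-if h g k (x ∷ xs) with h x ≟ k
... | yes hx≡k rewrite hx≡k | T⇒≡true (≡⇒≡ᵇ k k refl) =
  trans (cong (_+_ (g k)) (sum-map-if h g k xs)) (sym (*-suc (g k) _))
... | no  hx≢k rewrite ¬T⇒≡false (hx≢k ∘ ≡ᵇ⇒≡ (h x) k) = sum-map-if h g k xs

desCount : ℕ → ℕ → ℕ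
desCount n k = countL (λ π → des π ≡ᵇ k) (Av pR n)

desCount-split : ∀ n k → desCount (suc (suc n)) k ≡
  k * desCount (suc n) k + sum (map (λ σ → if suc (des σ) ≡ᵇ k then suc n ∸ des σ else 0) (Av pR (suc n)))
desCount-split n k = begin
  desCount (suc (suc n)) k
    ≡⟨ countL-↭ (λ π → des π ≡ᵇ k) (Av-suc↭extensions {suc n}) ⟩
  countL (λ π → des π ≡ᵇ k) (concatMap (extensions (suc n)) (Av pR (suc n)))
    ≡⟨ countL-concatMap (λ π → des π ≡ᵇ k) (extensions (suc n)) (Av pR (suc n)) ⟩
  sum (map (λ σ → countL (λ π → des π ≡ᵇ k) (extensions (suc n) σ)) (Av pR (suc n)))
    ≡⟨ sum-map-cong (Av pR (suc n)) (λ σ∈ → countL-des-extensions (proj₁ (∈Av⁻ pR (suc n) σ∈)) k) ⟩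
  sum (map (λ σ → f σ + g σ) (Av pR (suc n)))
    ≡⟨ sum-map-+ f g (Av pR (suc n)) ⟩
  sum (map f (Av pR (suc n))) + sum (map g (Av pR (suc n)))
    ≡⟨ cong (_+ sum (map g (Av pR (suc n)))) (sum-map-if des (λ d → d) k (Av pR (suc n))) ⟩
  k * desCount (suc n) k + sum (map g (Av pR (suc n))) ∎
  where
  open ≡-Reasoning
  f g : List ℕ → ℕ
  f σ = if des σ ≡ᵇ k then des σ else 0
  g σ = if suc (des σ) ≡ᵇ k then suc n ∸ des σ else 0

desCount-zero : ∀ n → desCount (suc (suc n)) 0 ≡ 0
desCount-zero n = trans (desCount-split n 0) (sum-map-const 0 (Av pR (suc n)))

desCount-suc : ∀ n k → desCount (suc (suc n)) (suc k) ≡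
  suc k * desCount (suc n) (suc k) + (suc n ∸ k) * desCount (suc n) k
desCount-suc n k = trans (desCount-split n (suc k))
  (cong (_+_ (suc k * desCount (suc n) (suc k))) (sum-map-if des (suc n ∸_) k (Av pR (suc n))))

desCount-vanish : ∀ n k → n < k → desCount (suc n) k ≡ 0
desCount-vanish n k n<k = countL-≡0 _ (Av pR (suc n)) λ {π} π∈ → ¬T⇒≡false λ t →
  <-irrefl (≡ᵇ⇒≡ (des π) k t) (≤-<-trans (IsPerm⇒des≤ (proj₁ (∈Av⁻ pR (suc n) π∈))) n<k)

length-Av-suc : ∀ n → length (Av pR (suc (suc n))) ≡ suc n * length (Av pR (suc n))
length-Av-suc n = begin
  length (Av pR (suc (suc n)))
    ≡⟨ ↭-length (Av-suc↭extensions {suc n}) ⟩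
  length (concatMap (extensions (suc n)) (Av pR (suc n)))
    ≡⟨ countL-true (concatMap (extensions (suc n)) (Av pR (suc n))) ⟨
  countL (λ _ → true) (concatMap (extensions (suc n)) (Av pR (suc n)))
    ≡⟨ countL-concatMap (λ _ → true) (extensions (suc n)) (Av pR (suc n)) ⟩
  sum (map (countL (λ _ → true) ∘ extensions (suc n)) (Av pR (suc n)))
    ≡⟨ sum-map-cong (Av pR (suc n)) (λ σ∈ → extensions-length (proj₁ (∈Av⁻ pR (suc n) σ∈))) ⟩
  sum (map (λ _ → suc n) (Av pR (suc n)))
    ≡⟨ sum-map-const (suc n) (Av pR (suc n)) ⟩
  suc n * length (Av pR (suc n)) ∎
  where
  open ≡-Reasoning
  extensions-length : ∀ {σ} → IsPerm (suc n) σ → countL (λ _ → true) (extensions (suc n) σ) ≡ suc n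
  extensions-length {σ} p = trans (countL-true (extensions (suc n) σ))
    (trans (length-map (λ s → insertOne s σ) (validSlots (suc n) σ)) (length-validSlots p))

desCount≡xEulerCoeff : ∀ n k → + desCount (suc (suc n)) k ≡ xEulerCoeff (suc n) k
desCount≡xEulerCoeff zero    zero          = refl
desCount≡xEulerCoeff zero    (suc zero)    = refl
desCount≡xEulerCoeff zero    (suc (suc j)) = sym (eulerCoeff-1-suc j)
desCount≡xEulerCoeff (suc n) zero          = cong +_ (desCount-zero (suc n))
desCount≡xEulerCoeff (suc n) (suc k)       =
  trans (cong +_ (desCount-suc (suc n) k))
        (pos-xEulerCoeff-rec (suc n) k _ _ (desCount≡xEulerCoeff n (suc k)) (desCount≡xEulerCoeff n k) k≤∨vanish)
  where
  k≤∨vanish : k ≤ suc (suc n) ⊎ desCount (suc (suc n)) k ≡ 0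
  k≤∨vanish with k ≤? suc (suc n)
  ... | yes k≤ = inj₁ k≤
  ... | no  k≰ = inj₂ (desCount-vanish (suc n) k (<-trans (n<1+n (suc n)) (≰⇒> k≰)))

length-Av : ∀ n → length (Av pR (suc n)) ≡ n !
length-Av zero    = refl
length-Av (suc n) = trans (length-Av-suc n) (cong (suc n *_) (length-Av n))

proposition4p6 :
    ((n : ℕ) → 2 ≤ n → (k : ℕ) →
      + countL (λ π → des π ≡ᵇ k) (Av pR n) ≡ xEulerCoeff (n ∸ 1) k)
    × ((n : ℕ) → 1 ≤ n → length (Av pR n) ≡ (n ∸ 1) !)
proposition4p6 = eulerian , factorial
  where
  eulerian : (n : ℕ) → 2 ≤ n → (k : ℕ) → + countL (λ π → des π ≡ᵇ k) (Av pR n) ≡ xEulerCoeff (n ∸ 1) k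
  eulerian (suc (suc n)) _         = desCount≡xEulerCoeff n
  eulerian (suc zero)    (s≤s ())
  factorial : (n : ℕ) → 1 ≤ n → length (Av pR n) ≡ (n ∸ 1) !
  factorial (suc n) _ = length-Av n
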